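{- Let $(a,b,c)$ be a primitive triple of positive integers with $a^2+b^2=2c^2$ and let $q_1,\dots,q_\ell$ be the distinct prime factors of $abc$. Let $k>1$, $\alpha=(\alpha_1,\dots,\alpha_k)$ with $\alpha_i\in\{1,5,9,13\}$, and $\mathbf B=(B_{ij})\in M_k(\mathbb F_2)$. Let $T_k(x)$ be the set of integers $n=p_1\cdots p_{k-1}\le x$ with primes $p_1<\cdots<p_{k-1}$ such that $p_i\equiv\alpha_i\pmod{16}$, $\left[\frac{p_j}{p_i}\right]=B_{ij}$ for $1\le i<j\le k-1$, and $\left(\frac{p_i}{q_j}\right)=1$ for all $1\le i\le k-1$, $1\le j\le\ell$. Let $T_k'(x)$ be the set of products $\eta=\lambda_1\cdots\lambda_{k-1}$ with $\mathbf N\eta\le x$, $\mathbf N\lambda_1<\cdots<\mathbf N\lambda_{k-1}$, $\lambda_i\in\mathcal P$, $\mathbf N\lambda_i\equiv\alpha_i\pmod{16}$, $\left[\frac{\mathbf N\lambda_j}{\mathbf N\lambda_i}\right]=B_{ij}$ for $1\le i<j\le k-1$, and $\left(\frac{\mathbf N\lambda_i}{q_j}\right)=1$ for all $i,j$. Then $\eta\mapsto\mathbf N\eta$ is a bijection $T_k'(x)\to T_k(x)$.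
   Context: $\mathbf N$ is the norm from $\mathbb Q(i)$ to $\mathbb Q$. A Gaussian integer is primary if $\equiv1\pmod{2+2i}$; $\mathcal P$ is the set of primary primes of $\mathbb Z[i]$ with positive imaginary part. $\left[\frac{u}{p}\right]\in\mathbb F_2$ is the additive Legendre symbol. -}

module Defs where

open import Data.Nat as ℕ using (ℕ; zero; suc; ∣_-_∣)
open import Data.Nat.Divisibility using (_∣?_)
open import Data.Integer as ℤ using (ℤ; +_; -[1+_])
open import Data.Fin as Fin using (Fin; zero; suc; inject₁)
open import Data.List using (List; upTo)
open import Data.List.Relation.Unary.Any using (any?)
open import Data.Product using (Σ; ∃; _×_)
open import Data.Empty using (⊥)
open import Data.Sum using (_⊎_)
open import Data.Bool using (if_then_else_)
open import Relation.Nullary using (does)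
open import Relation.Binary.PropositionalEquality using (_≡_)

record 𝔾 : Set where
  constructor _+_i
  field
    re : ℤ
    im : ℤ
open 𝔾 public

infixl 7 _*𝔾_
_*𝔾_ : 𝔾 → 𝔾 → 𝔾
(a + b i) *𝔾 (c + d i) = ((a ℤ.* c) ℤ.- (b ℤ.* d)) + ((a ℤ.* d) ℤ.+ (b ℤ.* c)) i

_-𝔾_ : 𝔾 → 𝔾 → 𝔾
(a + b i) -𝔾 (c + d i) = (a ℤ.- c) + (b ℤ.- d) i

0𝔾 1𝔾 : 𝔾
0𝔾 = (+ 0) + (+ 0) i
1𝔾 = (+ 1) + (+ 0) i

𝐍 : 𝔾 → ℕ
𝐍 (a + b i) = ℤ.∣ (a ℤ.* a) ℤ.+ (b ℤ.* b) ∣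

_∣𝔾_ : 𝔾 → 𝔾 → Set
x ∣𝔾 y = ∃ λ z → y ≡ x *𝔾 z

IsUnit𝔾 : 𝔾 → Set
IsUnit𝔾 u = ∃ λ v → u *𝔾 v ≡ 1𝔾

record Prime𝔾 (π : 𝔾) : Set where
  field
    nonzero : π ≡ 0𝔾 → ⊥
    nonunit : IsUnit𝔾 π → ⊥
    prime   : ∀ x y → π ∣𝔾 (x *𝔾 y) → (π ∣𝔾 x) ⊎ (π ∣𝔾 y)

Primary : 𝔾 → Set
Primary η = ((+ 2) + (+ 2) i) ∣𝔾 (η -𝔾 1𝔾)

In𝒫 : 𝔾 → Set
In𝒫 λ′ = Prime𝔾 λ′ × Primary λ′ × (ℤ.+ 0 ℤ.< im λ′)

legendre : ℕ → ℕ → ℤ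
legendre a p =
  if does (p ∣? a) then + 0
  else if does (any? (λ y → p ∣? ∣ y ℕ.* y - a ∣) (upTo p)) then + 1
  else -[1+ 0 ]

-- additive Legendre symbol [u/p] ∈ 𝔽₂ = Fin 2 : (u/p) = (-1)^[u/p]
addLegendre : ℕ → ℕ → Fin 2
addLegendre u p = if does (legendre u p ℤ.≟ -[1+ 0 ]) then suc zero else zero

prodℕ : ∀ {m} → (Fin m → ℕ) → ℕ
prodℕ {zero}  f = 1
prodℕ {suc m} f = f zero ℕ.* prodℕ (λ i → f (suc i))

prod𝔾 : ∀ {m} → (Fin m → 𝔾) → 𝔾
prod𝔾 {zero}  f = 1𝔾
prod𝔾 {suc m} f = f zero *𝔾 prod𝔾 (λ i → f (suc i))

-- The sets T_k(x) and T_k'(x), with k = suc m.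
-- Indices i : Fin m stand for 1 ≤ i ≤ k-1, embedded in Fin k by inject₁.

open import Data.Nat.Primality using (Prime)
open import Data.Nat.Divisibility using (_∣_)

InT : (a b c : ℕ) (m : ℕ) (α : Fin (suc m) → ℕ) (B : Fin (suc m) → Fin (suc m) → Fin 2)
      (x : ℕ) → ℕ → Set
InT a b c m α B x n =
  Σ (Fin m → ℕ) λ p →
    (n ≡ prodℕ p) × (n ℕ.≤ x)
    × (∀ i → Prime (p i))
    × (∀ i j → i Fin.< j → p i ℕ.< p j)
    × (∀ i → p i ℕ.% 16 ≡ α (inject₁ i))
    × (∀ i j → i Fin.< j → addLegendre (p j) (p i) ≡ B (inject₁ i) (inject₁ j))
    × (∀ i q → Prime q → q ∣ (a ℕ.* b ℕ.* c) → legendre (p i) q ≡ + 1)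

InT′ : (a b c : ℕ) (m : ℕ) (α : Fin (suc m) → ℕ) (B : Fin (suc m) → Fin (suc m) → Fin 2)
       (x : ℕ) → 𝔾 → Set
InT′ a b c m α B x η =
  Σ (Fin m → 𝔾) λ l →
    (η ≡ prod𝔾 l) × (𝐍 η ℕ.≤ x)
    × (∀ i → In𝒫 (l i))
    × (∀ i j → i Fin.< j → 𝐍 (l i) ℕ.< 𝐍 (l j))
    × (∀ i → 𝐍 (l i) ℕ.% 16 ≡ α (inject₁ i))
    × (∀ i j → i Fin.< j → addLegendre (𝐍 (l j)) (𝐍 (l i)) ≡ B (inject₁ i) (inject₁ j))
    × (∀ i q → Prime q → q ∣ (a ℕ.* b ℕ.* c) → legendre (𝐍 (l i)) q ≡ + 1)

-- A prime p ≡ 1 (mod 4) is a sum of two squares (Zagier): on the finite set of solutions of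
-- x² + 4yz = p, Zagier's involution has exactly one fixed point, so the involution
-- (x, y, z) ↦ (x, z, y) has one too, giving p = x² + (2y)². A Gaussian integer of prime norm is a
-- Gaussian prime, and one of ±x + 2yi is primary; so every such p is the norm of an element of 𝒫.
-- Conversely an element π of 𝒫 has prime norm, as π divides some rational prime q = π μ with μ not a
-- unit, and it is determined by its norm: if 𝐍 π = 𝐍 π′ then π divides π′ or its conjugate, and the
-- only primary associate of π is π itself. Since every condition defining T′(x) is a condition on
-- the norms 𝐍 λᵢ, and a product of increasing primes determines its factors, the norm map
-- T′(x) → T(x) is a bijection.
module Submission where

open import Defs
open import Relation.Binary.Definitions using (DecidableEquality)

module Involutions {A : Set} (_≟_ : DecidableEquality A) where
  open import Data.Nat using (suc; _+_; _*_; _≤_; s≤s)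
  open import Data.Nat.Properties using (≤-refl; ≤-trans; n≤1+n; even≢odd)
  open import Data.Nat.Tactic.RingSolver using (solve-∀)
  open import Data.List using (List; []; _∷_; length; filter)
  open import Data.List.Properties using (filter-none)
  open import Data.List.Membership.Propositional using (_∈_; _∉_; find)
  open import Data.List.Membership.Propositional.Properties using (∈-filter⁺; ∈-filter⁻)
  open import Data.List.Relation.Unary.Any using (here; there; any?)
  open import Data.List.Relation.Unary.All using (All; _∷_)
  open import Data.List.Relation.Unary.All.Properties using (All¬⇒¬Any; ¬Any⇒All¬)
  open import Data.List.Relation.Unary.AllPairs using ([]; _∷_)
  open import Data.List.Relation.Unary.Unique.Propositional using (Unique)
  import Data.List.Relation.Unary.Unique.Propositional.Properties as Unique
  open import Data.Product using (∃; _×_; _,_; proj₁; proj₂)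
  open import Data.Empty using (⊥-elim)
  open import Function using (_∘_; case_of_)
  open import Relation.Nullary using (yes; no; ¬?)
  open import Relation.Binary.PropositionalEquality

  fixedPoints : (A → A) → List A → List A
  fixedPoints f = filter (λ x → f x ≟ x)

  record IsInvolutionOn (f : A → A) (L : List A) : Set where
    field
      closed     : ∀ {x} → x ∈ L → f x ∈ L
      involutive : ∀ {x} → x ∈ L → f (f x) ≡ x

  private
    remove : A → List A → List A
    remove z = filter (λ y → ¬? (y ≟ z))

    remove-∉ : ∀ {z} L → z ∉ L → remove z L ≡ L
    remove-∉ [] _ = refl
    remove-∉ {z} (y ∷ L) z∉ with y ≟ z
    ... | yes refl = ⊥-elim (z∉ (here refl))
    ... | no _     = cong (y ∷_) (remove-∉ L (z∉ ∘ there))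

    length-remove : ∀ {z} L → Unique L → z ∈ L → length L ≡ suc (length (remove z L))
    length-remove (y ∷ L) (y∉ ∷ _) (here refl) with y ≟ y
    ... | yes _  = cong (suc ∘ length) (sym (remove-∉ L (All¬⇒¬Any y∉)))
    ... | no y≢y = ⊥-elim (y≢y refl)
    length-remove {z} (y ∷ L) (y∉ ∷ u) (there z∈) with y ≟ z
    ... | yes refl = ⊥-elim (All¬⇒¬Any y∉ z∈)
    ... | no _     = cong suc (length-remove L u z∈)

    fixedPoints-remove : ∀ f {z} L → f z ≢ z → fixedPoints f (remove z L) ≡ fixedPoints f L
    fixedPoints-remove f [] _ = refl
    fixedPoints-remove f {z} (y ∷ L) fz≢z with y ≟ z
    fixedPoints-remove f (y ∷ L) fz≢z | yes refl with f y ≟ y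
    ... | yes fy≡y = ⊥-elim (fz≢z fy≡y)
    ... | no _     = fixedPoints-remove f L fz≢z
    fixedPoints-remove f (y ∷ L) fz≢z | no _ with f y ≟ y
    ... | yes _ = cong (y ∷_) (fixedPoints-remove f L fz≢z)
    ... | no _  = fixedPoints-remove f L fz≢z

    module _ {f : A → A} {x : A} {L : List A} (x∉L : All (x ≢_) L) (inv : IsInvolutionOn f (x ∷ L)) where
      open IsInvolutionOn inv

      involutionOn-drop-fixed : f x ≡ x → IsInvolutionOn f L
      involutionOn-drop-fixed fx≡x .IsInvolutionOn.closed {y} y∈ with closed (there y∈)
      ... | there fy∈ = fy∈
      ... | here fy≡x = ⊥-elim (All¬⇒¬Any x∉L
              (subst (_∈ L) (trans (sym (involutive (there y∈))) (trans (cong f fy≡x) fx≡x)) y∈))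
      involutionOn-drop-fixed fx≡x .IsInvolutionOn.involutive y∈ = involutive (there y∈)

      involutionOn-drop-pair : f x ≢ x → IsInvolutionOn f (remove (f x) L)
      involutionOn-drop-pair fx≢x .IsInvolutionOn.closed y∈ with ∈-filter⁻ notFx {xs = L} y∈
        where notFx = λ y → ¬? (y ≟ f x)
      ... | y∈L , y≢fx with closed (there y∈L)
      ...   | here fy≡x = ⊥-elim (y≢fx (trans (sym (involutive (there y∈L))) (cong f fy≡x)))
      ...   | there fy∈ = ∈-filter⁺ (λ y → ¬? (y ≟ f x)) fy∈ λ fy≡fx → All¬⇒¬Any x∉L
                (subst (_∈ L) (trans (sym (involutive (there y∈L))) (trans (cong f fy≡fx) (involutive (here refl)))) y∈L)
      involutionOn-drop-pair fx≢x .IsInvolutionOn.involutive y∈ =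
        involutive (there (proj₁ (∈-filter⁻ (λ y → ¬? (y ≟ f x)) {xs = L} y∈)))

  -- The points that are not fixed come in pairs {x, f x}; induct on a bound for the length.
  length≡#fixedPoints+even : ∀ {f} L → Unique L → IsInvolutionOn f L →
                             ∃ λ k → length L ≡ length (fixedPoints f L) + 2 * k
  length≡#fixedPoints+even {f} L = go (length L) L ≤-refl
    where
    go : ∀ n L → length L ≤ n → Unique L → IsInvolutionOn f L →
         ∃ λ k → length L ≡ length (fixedPoints f L) + 2 * k
    go _ [] _ _ _ = 0 , refl
    go (suc n) (x ∷ L) (s≤s |L|≤n) (x∉L ∷ u) inv with f x ≟ x
    ... | yes fx≡x = let k , eq = go n L |L|≤n u (involutionOn-drop-fixed x∉L inv fx≡x) in k , cong suc eq
    ... | no fx≢x = suc k , (begin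
        suc (length L)                                 ≡⟨ cong suc |L|≡ ⟩
        suc (suc (length L′))                          ≡⟨ cong (suc ∘ suc) eq ⟩
        suc (suc (length (fixedPoints f L′) + 2 * k))  ≡⟨ cong (λ t → suc (suc (length t + 2 * k))) (fixedPoints-remove f L ffx≢fx) ⟩
        suc (suc (length (fixedPoints f L) + 2 * k))   ≡⟨ 2+a+2k≡a+2[1+k] (length (fixedPoints f L)) k ⟩
        length (fixedPoints f L) + 2 * suc k           ∎)
      where
      open ≡-Reasoning
      L′ = remove (f x) L
      |L|≡ : length L ≡ suc (length L′)
      |L|≡ = length-remove L u (case IsInvolutionOn.closed inv (here refl) of λ where
        (here fx≡x) → ⊥-elim (fx≢x fx≡x)
        (there fx∈L) → fx∈L)
      ffx≢fx : f (f x) ≢ f x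
      ffx≢fx ffx≡fx = fx≢x (trans (sym ffx≡fx) (IsInvolutionOn.involutive inv (here refl)))
      IH = go n L′ (≤-trans (n≤1+n _) (subst (_≤ n) |L|≡ |L|≤n)) (Unique.filter⁺ (λ y → ¬? (y ≟ f x)) u)
              (involutionOn-drop-pair x∉L inv fx≢x)
      k = proj₁ IH
      eq = proj₂ IH
      2+a+2k≡a+2[1+k] : ∀ a k → suc (suc (a + 2 * k)) ≡ a + 2 * suc k
      2+a+2k≡a+2[1+k] = solve-∀

  private
    length-fixedPoints≡1 : ∀ {f x₀} L → Unique L → x₀ ∈ L → f x₀ ≡ x₀ →
                           (∀ {x} → x ∈ L → f x ≡ x → x ≡ x₀) → length (fixedPoints f L) ≡ 1
    length-fixedPoints≡1 {f} {x₀} L u x₀∈ fx₀≡x₀ onlyX₀ =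
      singleton (Unique.filter⁺ fixed? u) (∈-filter⁺ fixed? x₀∈ fx₀≡x₀)
        (λ x∈ → let x∈L , fx≡x = ∈-filter⁻ fixed? {xs = L} x∈ in onlyX₀ x∈L fx≡x)
      where
      fixed? = λ x → f x ≟ x
      singleton : ∀ {F} → Unique F → x₀ ∈ F → (∀ {x} → x ∈ F → x ≡ x₀) → length F ≡ 1
      singleton {_ ∷ []} _ _ _ = refl
      singleton {_ ∷ _ ∷ _} ((x≢y ∷ _) ∷ _) _ onlyX₀ =
        ⊥-elim (x≢y (trans (onlyX₀ (here refl)) (sym (onlyX₀ (there (here refl))))))

  -- Both numbers of fixed points have the parity of length L.
  uniqueFixedPoint⇒fixedPoint : ∀ {f g x₀} L → Unique L → IsInvolutionOn f L → IsInvolutionOn g L →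
                                x₀ ∈ L → f x₀ ≡ x₀ → (∀ {x} → x ∈ L → f x ≡ x → x ≡ x₀) →
                                ∃ λ x → x ∈ L × g x ≡ x
  uniqueFixedPoint⇒fixedPoint {f} {g} L u invF invG x₀∈ fx₀≡x₀ onlyX₀ with any? (λ x → g x ≟ x) L
  ... | yes gHasFixed = find gHasFixed
  ... | no gHasNone = ⊥-elim (even≢odd k′ k (begin
      2 * k′                               ≡⟨ cong (_+ 2 * k′) (cong length noneG) ⟨
      length (fixedPoints g L) + 2 * k′    ≡⟨ eqG ⟨
      length L                             ≡⟨ eqF ⟩
      length (fixedPoints f L) + 2 * k     ≡⟨ cong (_+ 2 * k) (length-fixedPoints≡1 L u x₀∈ fx₀≡x₀ onlyX₀) ⟩
      suc (2 * k)                          ∎))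
    where
    open ≡-Reasoning
    k,eqF = length≡#fixedPoints+even L u invF
    k = proj₁ k,eqF
    eqF = proj₂ k,eqF
    k′,eqG = length≡#fixedPoints+even L u invG
    k′ = proj₁ k′,eqG
    eqG = proj₂ k′,eqG
    noneG : fixedPoints g L ≡ []
    noneG = filter-none (λ x → g x ≟ x) (¬Any⇒All¬ L gHasNone)

module FermatTwoSquares where
  open import Data.Nat using (ℕ; zero; suc; z<s; _+_; _*_; _∸_; _≤_; _<_; s≤s; z≤n; _≟_; _<?_; _≤?_; NonZero; nonTrivial⇒n>1)
  open import Data.Nat.Properties
  open import Data.Nat.Tactic.RingSolver using (solve-∀)
  open import Data.Nat.Divisibility using (divides)
  open import Data.Nat.Primality using (Prime; prime⇒irreducible; prime⇒nonTrivial; prime⇒nonZero)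
  open import Data.List using (List; filter; upTo; cartesianProduct)
  open import Data.List.Membership.Propositional using (_∈_)
  open import Data.List.Membership.Propositional.Properties using (∈-filter⁺; ∈-filter⁻; ∈-cartesianProduct⁺; ∈-upTo⁺)
  open import Data.List.Relation.Unary.Unique.Propositional using (Unique)
  import Data.List.Relation.Unary.Unique.Propositional.Properties as Unique
  open import Data.Product using (∃; ∃₂; _×_; _,_; proj₁; proj₂)
  open import Data.Product.Properties using (≡-dec)
  open import Data.Sum using (_⊎_; inj₁; inj₂)
  open import Data.Empty using (⊥-elim)
  open import Relation.Nullary using (Dec; yes; no)
  open import Relation.Nullary.Decidable using (_×-dec_)
  open import Relation.Binary using (tri<; tri≈; tri>)
  open import Relation.Binary.PropositionalEquality
  open import Function using (_∘_)

  even⊎odd : ∀ n → ∃ λ k → n ≡ 2 * k ⊎ n ≡ suc (2 * k)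
  even⊎odd zero = 0 , inj₁ refl
  even⊎odd (suc n) with even⊎odd n
  ... | k , inj₁ n≡2k   = k , inj₂ (cong suc n≡2k)
  ... | k , inj₂ n≡1+2k = suc k , inj₁ (trans (cong suc n≡1+2k) (2+2k≡2[1+k] k))
    where 2+2k≡2[1+k] : ∀ k → suc (suc (2 * k)) ≡ 2 * suc k
          2+2k≡2[1+k] = solve-∀

  Triple : Set
  Triple = ℕ × ℕ × ℕ

  _≟ᵀ_ : (s t : Triple) → Dec (s ≡ t)
  _≟ᵀ_ = ≡-dec _≟_ (≡-dec _≟_ _≟_)

  zagier : Triple → Triple
  zagier (x , y , z) with x + z <? y
  ... | yes _ = (x + 2 * z , z , y ∸ z ∸ x)
  ... | no _ with x <? 2 * y
  ...   | yes _ = (2 * y ∸ x , y , x + z ∸ y)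
  ...   | no _  = (x ∸ 2 * y , x + z ∸ y , y)

  swapYZ : Triple → Triple
  swapYZ (x , y , z) = (x , z , y)

  -- The three branches of zagier, parametrised so that no truncated subtraction remains.
  zagier-branch₁ : ∀ x z d → zagier (x , x + z + suc d , z) ≡ (x + 2 * z , z , suc d)
  zagier-branch₁ x z d with x + z <? x + z + suc d
  ... | yes _ = cong (λ w → (x + 2 * z , z , w)) (begin
      x + z + suc d ∸ z ∸ x    ≡⟨ cong (λ t → t ∸ z ∸ x) (x+z+d≡z+[x+d] x z (suc d)) ⟩
      z + (x + suc d) ∸ z ∸ x  ≡⟨ cong (_∸ x) (m+n∸m≡n z (x + suc d)) ⟩
      x + suc d ∸ x            ≡⟨ m+n∸m≡n x (suc d) ⟩
      suc d                    ∎)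
    where open ≡-Reasoning
          x+z+d≡z+[x+d] : ∀ x z d → x + z + d ≡ z + (x + d)
          x+z+d≡z+[x+d] = solve-∀
  ... | no x+z≮ = ⊥-elim (x+z≮ (m<m+n (x + z) z<s))

  zagier-branch₂ : ∀ x y z e g → x + z ≡ y + suc e → 2 * y ≡ x + suc g →
                   zagier (x , y , z) ≡ (suc g , y , suc e)
  zagier-branch₂ x y z e g x+z≡ 2y≡ with x + z <? y
  ... | yes x+z<y = ⊥-elim (<-asym x+z<y (subst (y <_) (sym x+z≡) (m<m+n y z<s)))
  ... | no _ with x <? 2 * y
  ...   | yes _ rewrite x+z≡ | 2y≡ | m+n∸m≡n x (suc g) | m+n∸m≡n y (suc e) = refl
  ...   | no x≮2y = ⊥-elim (x≮2y (subst (x <_) (sym 2y≡) (m<m+n x z<s)))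

  zagier-branch₃ : ∀ y z h → zagier (2 * y + suc h , y , z) ≡ (suc h , y + suc h + z , y)
  zagier-branch₃ y z h with 2 * y + suc h + z <? y
  ... | yes lt = ⊥-elim (<-irrefl refl (≤-trans lt (≤-trans (m≤m+n y (y + 0 + suc h + z)) (≤-reflexive (y+rest y h z)))))
    where y+rest : ∀ y h z → y + (y + 0 + suc h + z) ≡ 2 * y + suc h + z
          y+rest = solve-∀
  ... | no _ with 2 * y + suc h <? 2 * y
  ...   | yes lt = ⊥-elim (<-irrefl refl (≤-trans lt (m≤m+n (2 * y) (suc h))))
  ...   | no _ = cong₂ (λ a b → (a , b , y)) (m+n∸m≡n (2 * y) (suc h))
                   (trans (cong (_∸ y) (2y+h+z≡y+[y+h+z] y h z)) (m+n∸m≡n y (y + suc h + z)))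
    where 2y+h+z≡y+[y+h+z] : ∀ y h z → 2 * y + suc h + z ≡ y + (y + suc h + z)
          2y+h+z≡y+[y+h+z] = solve-∀

  triplesBelow : ℕ → List Triple
  triplesBelow n = cartesianProduct (upTo n) (cartesianProduct (upTo n) (upTo n))

  data ZagierView : Triple → Set where
    branch₁ : ∀ x z d → ZagierView (x , x + z + suc d , z)
    branch₂ : ∀ x y z e g → x + z ≡ y + suc e → 2 * y ≡ x + suc g → ZagierView (x , y , z)
    branch₃ : ∀ y z h → ZagierView (2 * y + suc h , y , z)

  module Windmills (p k : ℕ) (p-prime : Prime p) (p≡1+4k : p ≡ 1 + 4 * k) where

    IsWindmill : Triple → Set
    IsWindmill (x , y , z) = (x * x + 4 * (y * z) ≡ p) × (1 ≤ y) × (1 ≤ z)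

    isWindmill? : ∀ t → Dec (IsWindmill t)
    isWindmill? (x , y , z) = (x * x + 4 * (y * z) ≟ p) ×-dec ((1 ≤? y) ×-dec (1 ≤? z))

    private
      p≥2 : 2 ≤ p
      p≥2 = nonTrivial⇒n>1 p {{prime⇒nonTrivial p-prime}}

      instance
        p≢0 : NonZero p
        p≢0 = prime⇒nonZero p-prime

    p≢even : ∀ n → p ≢ 2 * n
    p≢even n p≡2n = even≢odd n (2 * k) (trans (sym p≡2n) (trans p≡1+4k (cong suc (4k≡2[2k] k))))
      where 4k≡2[2k] : ∀ k → 4 * k ≡ 2 * (2 * k)
            4k≡2[2k] = solve-∀

    p≢square : ∀ w → p ≢ w * w
    p≢square w p≡w² with prime⇒irreducible p-prime (divides w (trans p≡w² (*-comm w w)))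
    ... | inj₁ refl = <-irrefl (sym p≡w²) p≥2
    ... | inj₂ refl = <-irrefl (*-cancelˡ-≡ 1 p p (trans (*-identityʳ p) p≡w²)) p≥2

    windmill-x≢0 : ∀ y z → 0 * 0 + 4 * (y * z) ≢ p
    windmill-x≢0 y z eq = p≢even (2 * (y * z)) (trans (sym eq) (4a≡2[2a] (y * z)))
      where 4a≡2[2a] : ∀ a → 0 * 0 + 4 * a ≡ 2 * (2 * a)
            4a≡2[2a] = solve-∀

    -- The boundary cases x + z = y and x = 2y are excluded: p would be a square, resp. even.
    zagierView : ∀ t → IsWindmill t → ZagierView t
    zagierView (x , y , z) (eq , _ , _) with <-cmp (x + z) y
    ... | tri< lt _ _ = let d , x+z+1+d≡y = m≤n⇒∃[o]m+o≡n lt in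
          subst (λ w → ZagierView (x , w , z)) (trans (+-suc (x + z) d) x+z+1+d≡y) (branch₁ x z d)
    ... | tri≈ _ x+z≡y _ = ⊥-elim (p≢square (x + 2 * z)
            (trans (sym eq) (trans (cong (λ w → x * x + 4 * (w * z)) (sym x+z≡y)) (square x z))))
      where square : ∀ x z → x * x + 4 * ((x + z) * z) ≡ (x + 2 * z) * (x + 2 * z)
            square = solve-∀
    ... | tri> _ _ gt with m≤n⇒∃[o]m+o≡n gt
    ...   | e , y+1+e≡x+z with <-cmp x (2 * y)
    ...     | tri< lt _ _ = let g , x+1+g≡2y = m≤n⇒∃[o]m+o≡n lt in
              branch₂ x y z e g (trans (sym y+1+e≡x+z) (sym (+-suc y e))) (trans (sym x+1+g≡2y) (sym (+-suc x g)))
    ...     | tri≈ _ x≡2y _ = ⊥-elim (p≢even (2 * (y * y) + 2 * (y * z))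
              (trans (sym eq) (trans (cong (λ w → w * w + 4 * (y * z)) x≡2y) (even y z))))
      where even : ∀ y z → 2 * y * (2 * y) + 4 * (y * z) ≡ 2 * (2 * (y * y) + 2 * (y * z))
            even = solve-∀
    ...     | tri> _ _ gt′ = let h , 2y+1+h≡x = m≤n⇒∃[o]m+o≡n gt′ in
              subst (λ w → ZagierView (w , y , z)) (trans (+-suc (2 * y) h) 2y+1+h≡x) (branch₃ y z h)

    private
      -- The branch-2 image (2y − x, y, x + z − y) of a windmill, checked without subtraction.
      reflect-preserves-norm : ∀ x y z G E → 2 * y ≡ x + G → G + E ≡ y + z →
                               G * G + 4 * (y * E) ≡ x * x + 4 * (y * z)
      reflect-preserves-norm x y z G E 2y≡x+G G+E≡y+z = +-cancelʳ-≡ (4 * (y * G)) _ _ (begin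
        G * G + 4 * (y * E) + 4 * (y * G)      ≡⟨ r₁ G y E ⟩
        G * G + 4 * (y * (G + E))              ≡⟨ cong (λ w → G * G + 4 * (y * w)) G+E≡y+z ⟩
        G * G + 4 * (y * (y + z))              ≡⟨ r₂ G y z ⟩
        G * G + 2 * y * (2 * y) + 4 * (y * z)  ≡⟨ cong (λ w → G * G + w * w + 4 * (y * z)) 2y≡x+G ⟩
        G * G + (x + G) * (x + G) + 4 * (y * z) ≡⟨ r₃ G x y z ⟩
        x * x + 2 * (x + G) * G + 4 * (y * z)  ≡⟨ cong (λ w → x * x + w * G + 4 * (y * z)) (cong (2 *_) 2y≡x+G) ⟨
        x * x + 2 * (2 * y) * G + 4 * (y * z)  ≡⟨ r₄ x y z G ⟩
        x * x + 4 * (y * z) + 4 * (y * G)      ∎)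
        where
        open ≡-Reasoning
        r₁ : ∀ G y E → G * G + 4 * (y * E) + 4 * (y * G) ≡ G * G + 4 * (y * (G + E))
        r₁ = solve-∀
        r₂ : ∀ G y z → G * G + 4 * (y * (y + z)) ≡ G * G + 2 * y * (2 * y) + 4 * (y * z)
        r₂ = solve-∀
        r₃ : ∀ G x y z → G * G + (x + G) * (x + G) + 4 * (y * z) ≡ x * x + 2 * (x + G) * G + 4 * (y * z)
        r₃ = solve-∀
        r₄ : ∀ x y z G → x * x + 2 * (2 * y) * G + 4 * (y * z) ≡ x * x + 4 * (y * z) + 4 * (y * G)
        r₄ = solve-∀

      zagier-involutive₁ : ∀ x z d → IsWindmill (x , x + z + suc d , z) →
        IsWindmill (x + 2 * z , z , suc d) × zagier (x + 2 * z , z , suc d) ≡ (x , x + z + suc d , z)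
      zagier-involutive₁ zero z d (eq , _) = ⊥-elim (windmill-x≢0 (0 + z + suc d) z eq)
      zagier-involutive₁ (suc h) z d (eq , _ , 1≤z) =
        (trans (norm (suc h) z d) eq , 1≤z , s≤s z≤n) ,
        (begin
          zagier (suc h + 2 * z , z , suc d)  ≡⟨ cong (λ w → zagier (w , z , suc d)) (+-comm (suc h) (2 * z)) ⟩
          zagier (2 * z + suc h , z , suc d)  ≡⟨ zagier-branch₃ z (suc d) h ⟩
          (suc h , z + suc h + suc d , z)     ≡⟨ cong (λ w → (suc h , w , z)) (+-comm z (suc h) |> cong (_+ suc d)) ⟩
          (suc h , suc h + z + suc d , z)     ∎)
        where
        open ≡-Reasoning
        open import Function using (_|>_)
        norm : ∀ x z d → (x + 2 * z) * (x + 2 * z) + 4 * (z * suc d) ≡ x * x + 4 * ((x + z + suc d) * z)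
        norm = solve-∀

      zagier-involutive₂ : ∀ x y z e g → x + z ≡ y + suc e → 2 * y ≡ x + suc g → IsWindmill (x , y , z) →
        IsWindmill (suc g , y , suc e) × zagier (suc g , y , suc e) ≡ (x , y , z)
      zagier-involutive₂ zero y z _ _ _ _ (eq , _) = ⊥-elim (windmill-x≢0 y z eq)
      zagier-involutive₂ (suc x′) y (suc z′) e g x+z≡ 2y≡ (eq , 1≤y , _) =
        (trans (reflect-preserves-norm (suc x′) y (suc z′) (suc g) (suc e) 2y≡ G+E≡y+z) eq , 1≤y , s≤s z≤n) ,
        zagier-branch₂ (suc g) y (suc e) z′ x′ G+E≡y+z (trans 2y≡ (+-comm (suc x′) (suc g)))
        where
        open ≡-Reasoning
        G+E≡y+z : suc g + suc e ≡ y + suc z′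
        G+E≡y+z = +-cancelˡ-≡ (suc x′ + y) _ _ (begin
          suc x′ + y + (suc g + suc e)      ≡⟨ r₁ (suc x′) y (suc g) (suc e) ⟩
          (suc x′ + suc g) + (y + suc e)    ≡⟨ cong₂ _+_ 2y≡ x+z≡ ⟨
          2 * y + (suc x′ + suc z′)         ≡⟨ r₂ y (suc x′) (suc z′) ⟩
          suc x′ + y + (y + suc z′)         ∎)
          where
          r₁ : ∀ x y G E → x + y + (G + E) ≡ (x + G) + (y + E)
          r₁ = solve-∀
          r₂ : ∀ y x z → 2 * y + (x + z) ≡ x + y + (y + z)
          r₂ = solve-∀

      zagier-involutive₃ : ∀ y z h → IsWindmill (2 * y + suc h , y , z) →
        IsWindmill (suc h , y + suc h + z , y) × zagier (suc h , y + suc h + z , y) ≡ (2 * y + suc h , y , z)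
      zagier-involutive₃ y (suc z′) h (eq , 1≤y , _) =
        (trans (norm y h (suc z′)) eq , ≤-trans (s≤s z≤n) (m≤n+m (suc z′) (y + suc h)) , 1≤y) ,
        (begin
          zagier (suc h , y + suc h + suc z′ , y)  ≡⟨ cong (λ w → zagier (suc h , w + suc z′ , y)) (+-comm y (suc h)) ⟩
          zagier (suc h , suc h + y + suc z′ , y)  ≡⟨ zagier-branch₁ (suc h) y z′ ⟩
          (suc h + 2 * y , y , suc z′)             ≡⟨ cong (λ w → (w , y , suc z′)) (+-comm (suc h) (2 * y)) ⟩
          (2 * y + suc h , y , suc z′)             ∎)
        where
        open ≡-Reasoning
        norm : ∀ y h z → suc h * suc h + 4 * ((y + suc h + z) * y) ≡ (2 * y + suc h) * (2 * y + suc h) + 4 * (y * z)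
        norm = solve-∀

    zagier-involutive : ∀ t → IsWindmill t → IsWindmill (zagier t) × zagier (zagier t) ≡ t
    zagier-involutive t w = go (zagierView t w) w
      where
      go : ∀ {t} → ZagierView t → IsWindmill t → IsWindmill (zagier t) × zagier (zagier t) ≡ t
      go (branch₁ x z d) w rewrite zagier-branch₁ x z d = zagier-involutive₁ x z d w
      go (branch₂ x y z e g x+z≡ 2y≡) w rewrite zagier-branch₂ x y z e g x+z≡ 2y≡ = zagier-involutive₂ x y z e g x+z≡ 2y≡ w
      go (branch₃ y z h) w rewrite zagier-branch₃ y z h = zagier-involutive₃ y z h w

    private
      -- A fixed point of the middle branch has the form (G, G, E), so G ∣ p; and G = p is too large.
      fixed-branch₂ : ∀ G E → G * G + 4 * (G * E) ≡ p → G ≡ 1 × E ≡ k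
      fixed-branch₂ G E eq with prime⇒irreducible p-prime (divides (G + 4 * E) (trans (sym eq) (factor G E)))
        where factor : ∀ G E → G * G + 4 * (G * E) ≡ (G + 4 * E) * G
              factor = solve-∀
      ... | inj₁ refl = refl , *-cancelˡ-≡ E k 4 (suc-injective (trans (cong (λ w → 1 + 4 * w) (sym (*-identityˡ E))) (trans eq p≡1+4k)))
      ... | inj₂ refl = ⊥-elim (<-irrefl refl (≤-trans p≥2 (*-cancelˡ-≤ p (begin
            p * p                    ≤⟨ m≤m+n (p * p) (4 * (p * E)) ⟩
            p * p + 4 * (p * E)      ≡⟨ eq ⟩
            p                        ≡⟨ *-identityʳ p ⟨
            p * 1                    ∎))))
        where open ≤-Reasoning

    zagier-fixed⇒ : ∀ t → IsWindmill t → zagier t ≡ t → t ≡ (1 , 1 , k)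
    zagier-fixed⇒ t w = go (zagierView t w) w
      where
      go : ∀ {t} → ZagierView t → IsWindmill t → zagier t ≡ t → t ≡ (1 , 1 , k)
      go (branch₁ x z d) _ fixed rewrite zagier-branch₁ x z d =
        ⊥-elim (m+1+n≢m z (sym (trans (cong (proj₁ ∘ proj₂) fixed) (x+z+1+d≡z+1+[x+d] x z d))))
        where x+z+1+d≡z+1+[x+d] : ∀ x z d → x + z + suc d ≡ z + suc (x + d)
              x+z+1+d≡z+1+[x+d] = solve-∀
      go (branch₃ zero z h) (_ , () , _) _
      go (branch₃ (suc y) z h) _ fixed rewrite zagier-branch₃ (suc y) z h =
        ⊥-elim (m+1+n≢m (suc h) (sym (trans (cong proj₁ fixed) (2[1+y]+1+h≡1+h+1+[1+2y] y h))))
        where 2[1+y]+1+h≡1+h+1+[1+2y] : ∀ y h → 2 * suc y + suc h ≡ suc h + suc (suc (2 * y))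
              2[1+y]+1+h≡1+h+1+[1+2y] = solve-∀
      go (branch₂ x y z e g x+z≡ 2y≡) (eq , _) fixed rewrite zagier-branch₂ x y z e g x+z≡ 2y≡ with fixed
      ... | refl with *-cancelˡ-≡ y (suc g) 2 (trans 2y≡ (x+x≡2x (suc g)))
        where x+x≡2x : ∀ x → x + x ≡ 2 * x
              x+x≡2x = solve-∀
      ...   | refl with fixed-branch₂ (suc g) (suc e) eq
      ...     | refl , refl = refl

    windmills : List Triple
    windmills = filter isWindmill? (triplesBelow (suc p))

    windmills-unique : Unique windmills
    windmills-unique = Unique.filter⁺ isWindmill?
      (Unique.cartesianProduct⁺ range (Unique.cartesianProduct⁺ range range))
      where range = Unique.upTo⁺ (suc p)

    ∈windmills⁻ : ∀ {t} → t ∈ windmills → IsWindmill t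
    ∈windmills⁻ t∈ = proj₂ (∈-filter⁻ isWindmill? {xs = triplesBelow (suc p)} t∈)

    ∈windmills⁺ : ∀ {t} → IsWindmill t → t ∈ windmills
    ∈windmills⁺ {x , suc y , suc z} w@(eq , _) = ∈-filter⁺ isWindmill?
      (∈-cartesianProduct⁺ (∈-upTo⁺ x<1+p) (∈-cartesianProduct⁺ (∈-upTo⁺ y<1+p) (∈-upTo⁺ z<1+p))) w
      where
      yz≤p : suc y * suc z ≤ p
      yz≤p = ≤-trans (m≤n*m _ 4) (≤-trans (m≤n+m _ (x * x)) (≤-reflexive eq))
      x<1+p : x < suc p
      x<1+p = s≤s (≤-trans (m≤m*m x) (≤-trans (m≤m+n (x * x) _) (≤-reflexive eq)))
        where m≤m*m : ∀ m → m ≤ m * m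
              m≤m*m zero = z≤n
              m≤m*m (suc m) = m≤m*n (suc m) (suc m)
      y<1+p : suc y < suc p
      y<1+p = s≤s (≤-trans (m≤m*n (suc y) (suc z)) yz≤p)
      z<1+p : suc z < suc p
      z<1+p = s≤s (≤-trans (m≤n*m (suc z) (suc y)) yz≤p)

    open Involutions _≟ᵀ_

    zagier-isInvolutionOn : IsInvolutionOn zagier windmills
    zagier-isInvolutionOn = record
      { closed     = λ t∈ → ∈windmills⁺ (proj₁ (zagier-involutive _ (∈windmills⁻ t∈)))
      ; involutive = λ t∈ → proj₂ (zagier-involutive _ (∈windmills⁻ t∈))
      }

    swapYZ-isInvolutionOn : IsInvolutionOn swapYZ windmills
    swapYZ-isInvolutionOn = record
      { closed     = λ { {x , y , z} t∈ → let eq , 1≤y , 1≤z = ∈windmills⁻ t∈ in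
                         ∈windmills⁺ (trans (cong (λ w → x * x + 4 * w) (*-comm z y)) eq , 1≤z , 1≤y) }
      ; involutive = λ _ → refl
      }

    trivialWindmill : IsWindmill (1 , 1 , k) × zagier (1 , 1 , k) ≡ (1 , 1 , k)
    trivialWindmill = go k refl
      where
      go : ∀ j → k ≡ j → IsWindmill (1 , 1 , j) × zagier (1 , 1 , j) ≡ (1 , 1 , j)
      go zero    k≡0 = ⊥-elim (<-irrefl (sym (trans p≡1+4k (cong (λ w → 1 + 4 * w) k≡0))) p≥2)
      go (suc e) k≡  = (trans (cong (λ w → 1 + 4 * w) (*-identityˡ (suc e))) (sym (trans p≡1+4k (cong (λ w → 1 + 4 * w) k≡)))
                       , s≤s z≤n , s≤s z≤n)
                     , zagier-branch₂ 1 1 (suc e) e 0 refl refl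

    swapYZ-fixedPoint : ∃ λ t → t ∈ windmills × swapYZ t ≡ t
    swapYZ-fixedPoint = uniqueFixedPoint⇒fixedPoint windmills windmills-unique
      zagier-isInvolutionOn swapYZ-isInvolutionOn
      (∈windmills⁺ (proj₁ trivialWindmill)) (proj₂ trivialWindmill)
      (λ t∈ → zagier-fixed⇒ _ (∈windmills⁻ t∈))

  prime≡1+4k⇒oddSquare+4square : ∀ p k → Prime p → p ≡ 1 + 4 * k →
                                  ∃₂ λ s y → suc (2 * s) * suc (2 * s) + 4 * (y * y) ≡ p × 1 ≤ y
  prime≡1+4k⇒oddSquare+4square p k p-prime p≡1+4k with swapYZ-fixedPoint
    where open Windmills p k p-prime p≡1+4k
  ... | (x , y , .y) , t∈ , refl with ∈windmills⁻ t∈ | even⊎odd x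
    where open Windmills p k p-prime p≡1+4k
  ... | eq , 1≤y , _ | s , inj₂ refl = s , y , eq , 1≤y
  ... | eq , _       | s , inj₁ refl = ⊥-elim (p≢even (2 * (s * s) + 2 * (y * y)) (trans (sym eq) (even s y)))
    where open Windmills p k p-prime p≡1+4k
          even : ∀ s y → 2 * s * (2 * s) + 4 * (y * y) ≡ 2 * (2 * (s * s) + 2 * (y * y))
          even = solve-∀

module GaussianIntegers where
  open import Data.Integer using (ℤ; +_; -[1+_]; _+_; _*_; _-_; -_; ∣_∣)
  import Data.Integer.Properties as ℤ
  open import Data.Integer.Tactic.RingSolver using (solve-∀)
  import Data.Nat as ℕ
  open ℕ using (ℕ; zero; suc)
  import Data.Nat.Properties as ℕ
  open import Data.Product using (_×_; _,_)
  open import Data.Sum using (_⊎_; inj₁; inj₂)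
  open import Data.Empty using (⊥-elim)
  open import Relation.Binary.PropositionalEquality

  conj : 𝔾 → 𝔾
  conj (a + b i) = a + (- b) i

  ι : ℕ → 𝔾
  ι n = (+ n) + (+ 0) i

  -1𝔾 i𝔾 -i𝔾 : 𝔾
  -1𝔾 = -[1+ 0 ] + (+ 0) i
  i𝔾  = (+ 0) + (+ 1) i
  -i𝔾 = (+ 0) + -[1+ 0 ] i

  *𝔾-comm : ∀ z w → z *𝔾 w ≡ w *𝔾 z
  *𝔾-comm (a + b i) (c + d i) = cong₂ _+_i (re≡ a b c d) (im≡ a b c d)
    where re≡ : ∀ a b c d → a * c - b * d ≡ c * a - d * b
          re≡ = solve-∀
          im≡ : ∀ a b c d → a * d + b * c ≡ c * b + d * a
          im≡ = solve-∀

  *𝔾-assoc : ∀ z w v → (z *𝔾 w) *𝔾 v ≡ z *𝔾 (w *𝔾 v)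
  *𝔾-assoc (a + b i) (c + d i) (e + f i) = cong₂ _+_i (re≡ a b c d e f) (im≡ a b c d e f)
    where re≡ : ∀ a b c d e f → (a * c - b * d) * e - (a * d + b * c) * f ≡ a * (c * e - d * f) - b * (c * f + d * e)
          re≡ = solve-∀
          im≡ : ∀ a b c d e f → (a * c - b * d) * f + (a * d + b * c) * e ≡ a * (c * f + d * e) + b * (c * e - d * f)
          im≡ = solve-∀

  *𝔾-identityʳ : ∀ z → z *𝔾 1𝔾 ≡ z
  *𝔾-identityʳ (a + b i) = cong₂ _+_i (re≡ a b) (im≡ a b)
    where re≡ : ∀ a b → a * + 1 - b * + 0 ≡ a
          re≡ = solve-∀
          im≡ : ∀ a b → a * + 0 + b * + 1 ≡ b
          im≡ = solve-∀

  *𝔾-distribˡ-sub : ∀ z w v → z *𝔾 (w -𝔾 v) ≡ (z *𝔾 w) -𝔾 (z *𝔾 v)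
  *𝔾-distribˡ-sub (a + b i) (c + d i) (e + f i) = cong₂ _+_i (re≡ a b c d e f) (im≡ a b c d e f)
    where re≡ : ∀ a b c d e f → a * (c - e) - b * (d - f) ≡ (a * c - b * d) - (a * e - b * f)
          re≡ = solve-∀
          im≡ : ∀ a b c d e f → a * (d - f) + b * (c - e) ≡ (a * d + b * c) - (a * f + b * e)
          im≡ = solve-∀

  ι-* : ∀ m n → ι (m ℕ.* n) ≡ ι m *𝔾 ι n
  ι-* m n = cong₂ _+_i (trans (ℤ.pos-* m n) (re≡ (+ m) (+ n))) (im≡ (+ m) (+ n))
    where re≡ : ∀ a b → a * b ≡ a * b - + 0 * + 0
          re≡ = solve-∀
          im≡ : ∀ a b → + 0 ≡ a * + 0 + + 0 * b
          im≡ = solve-∀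

  private
    square≡∣∣² : ∀ a → a * a ≡ + (∣ a ∣ ℕ.* ∣ a ∣)
    square≡∣∣² (+ n)    = sym (ℤ.pos-* n n)
    square≡∣∣² -[1+ n ] = refl

  +𝐍 : ∀ z → + 𝐍 z ≡ re z * re z + im z * im z
  +𝐍 (a + b i) rewrite square≡∣∣² a | square≡∣∣² b = refl

  𝐍≡∣re∣²+∣im∣² : ∀ z → 𝐍 z ≡ ∣ re z ∣ ℕ.* ∣ re z ∣ ℕ.+ ∣ im z ∣ ℕ.* ∣ im z ∣
  𝐍≡∣re∣²+∣im∣² (a + b i) rewrite square≡∣∣² a | square≡∣∣² b = refl

  𝐍-* : ∀ z w → 𝐍 (z *𝔾 w) ≡ 𝐍 z ℕ.* 𝐍 w
  𝐍-* (a + b i) (c + d i) = trans (cong ∣_∣ (brahmagupta a b c d)) (ℤ.abs-* (a * a + b * b) (c * c + d * d))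
    where brahmagupta : ∀ a b c d → (a * c - b * d) * (a * c - b * d) + (a * d + b * c) * (a * d + b * c)
                                    ≡ (a * a + b * b) * (c * c + d * d)
          brahmagupta = solve-∀

  𝐍-conj : ∀ z → 𝐍 (conj z) ≡ 𝐍 z
  𝐍-conj (a + b i) = cong ∣_∣ (neg² a b)
    where neg² : ∀ a b → a * a + (- b) * (- b) ≡ a * a + b * b
          neg² = solve-∀

  𝐍-ι : ∀ n → 𝐍 (ι n) ≡ n ℕ.* n
  𝐍-ι n = trans (𝐍≡∣re∣²+∣im∣² (ι n)) (ℕ.+-identityʳ (n ℕ.* n))

  *-conj≡ι𝐍 : ∀ z → z *𝔾 conj z ≡ ι (𝐍 z)
  *-conj≡ι𝐍 z@(a + b i) = cong₂ _+_i (trans (re≡ a b) (sym (+𝐍 z))) (im≡ a b)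
    where re≡ : ∀ a b → a * a - b * (- b) ≡ a * a + b * b
          re≡ = solve-∀
          im≡ : ∀ a b → a * (- b) + b * a ≡ + 0
          im≡ = solve-∀

  𝐍≡0⇒≡0 : ∀ z → 𝐍 z ≡ 0 → z ≡ 0𝔾
  𝐍≡0⇒≡0 z@(a + b i) 𝐍z≡0 with ∣ a ∣ in ∣a∣≡ | ∣ b ∣ in ∣b∣≡ | trans (sym (𝐍≡∣re∣²+∣im∣² z)) 𝐍z≡0
  ... | zero | zero | _ = cong₂ _+_i (ℤ.∣i∣≡0⇒i≡0 ∣a∣≡) (ℤ.∣i∣≡0⇒i≡0 ∣b∣≡)

  ≢0⇒𝐍≢0 : ∀ {z} → z ≢ 0𝔾 → ℕ.NonZero (𝐍 z)
  ≢0⇒𝐍≢0 {z} z≢0 = ℕ.≢-nonZero (z≢0 ∘ 𝐍≡0⇒≡0 z)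
    where open import Function using (_∘_)

  *𝔾-cancelˡ : ∀ z w v → z ≢ 0𝔾 → z *𝔾 w ≡ z *𝔾 v → w ≡ v
  *𝔾-cancelˡ z w v z≢0 zw≡zv with ℕ.m*n≡0⇒m≡0∨n≡0 (𝐍 z) 𝐍[z[w-v]]≡0
    where
    𝐍[z[w-v]]≡0 : 𝐍 z ℕ.* 𝐍 (w -𝔾 v) ≡ 0
    𝐍[z[w-v]]≡0 = trans (sym (𝐍-* z (w -𝔾 v))) (cong 𝐍 (begin
      z *𝔾 (w -𝔾 v)            ≡⟨ *𝔾-distribˡ-sub z w v ⟩
      (z *𝔾 w) -𝔾 (z *𝔾 v)     ≡⟨ cong (_-𝔾 (z *𝔾 v)) zw≡zv ⟩
      (z *𝔾 v) -𝔾 (z *𝔾 v)     ≡⟨ cong₂ _+_i (ℤ.+-inverseʳ (re (z *𝔾 v))) (ℤ.+-inverseʳ (im (z *𝔾 v))) ⟩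
      0𝔾                       ∎))
      where open ≡-Reasoning
  ... | inj₁ 𝐍z≡0 = ⊥-elim (z≢0 (𝐍≡0⇒≡0 z 𝐍z≡0))
  ... | inj₂ 𝐍[w-v]≡0 with 𝐍≡0⇒≡0 (w -𝔾 v) 𝐍[w-v]≡0
  ...   | w-v≡0 = cong₂ _+_i (ℤ.i-j≡0⇒i≡j (re w) (re v) (cong re w-v≡0)) (ℤ.i-j≡0⇒i≡j (im w) (im v) (cong im w-v≡0))

  data Unit : 𝔾 → Set where
    u₁  : Unit 1𝔾
    u₋₁ : Unit -1𝔾
    uᵢ  : Unit i𝔾
    u₋ᵢ : Unit -i𝔾

  private
    ∣i∣≡1 : ∀ a → ∣ a ∣ ≡ 1 → a ≡ + 1 ⊎ a ≡ -[1+ 0 ]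
    ∣i∣≡1 (+ .1)        refl = inj₁ refl
    ∣i∣≡1 -[1+ zero ]   _    = inj₂ refl

    m²+n²≡1 : ∀ m n → m ℕ.* m ℕ.+ n ℕ.* n ≡ 1 → (m ≡ 1 × n ≡ 0) ⊎ (m ≡ 0 × n ≡ 1)
    m²+n²≡1 zero          n    e = inj₂ (refl , ℕ.m*n≡1⇒m≡1 n n e)
    m²+n²≡1 (suc zero)    zero _ = inj₁ (refl , refl)

  𝐍≡1⇒Unit : ∀ u → 𝐍 u ≡ 1 → Unit u
  𝐍≡1⇒Unit u@(a + b i) 𝐍u≡1 with m²+n²≡1 ∣ a ∣ ∣ b ∣ (trans (sym (𝐍≡∣re∣²+∣im∣² u)) 𝐍u≡1)
  ... | inj₁ (∣a∣≡1 , ∣b∣≡0) with ∣i∣≡1 a ∣a∣≡1 | ℤ.∣i∣≡0⇒i≡0 {b} ∣b∣≡0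
  ...   | inj₁ refl | refl = u₁
  ...   | inj₂ refl | refl = u₋₁
  𝐍≡1⇒Unit (a + b i) _ | inj₂ (∣a∣≡0 , ∣b∣≡1) with ℤ.∣i∣≡0⇒i≡0 {a} ∣a∣≡0 | ∣i∣≡1 b ∣b∣≡1
  ...   | refl | inj₁ refl = uᵢ
  ...   | refl | inj₂ refl = u₋ᵢ

  IsUnit𝔾⇒𝐍≡1 : ∀ u → IsUnit𝔾 u → 𝐍 u ≡ 1
  IsUnit𝔾⇒𝐍≡1 u (v , uv≡1) = ℕ.m*n≡1⇒m≡1 (𝐍 u) (𝐍 v) (trans (sym (𝐍-* u v)) (cong 𝐍 uv≡1))

  𝐍≡1⇒IsUnit𝔾 : ∀ u → 𝐍 u ≡ 1 → IsUnit𝔾 u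
  𝐍≡1⇒IsUnit𝔾 u 𝐍u≡1 = conj u , trans (*-conj≡ι𝐍 u) (cong ι 𝐍u≡1)

module PrimaryElements where
  open GaussianIntegers
  open import Data.Integer using (ℤ; +_; -[1+_]; _+_; _*_; _-_; -_; ∣_∣)
  import Data.Integer.Properties as ℤ
  open import Data.Integer.Tactic.RingSolver using (solve-∀)
  import Data.Nat as ℕ
  open import Data.Nat.Properties using (even≢odd)
  open import Data.Product using (∃; _×_; _,_)
  open import Data.Empty using (⊥-elim)
  open import Relation.Binary.PropositionalEquality
  open ≡-Reasoning

  1+2m≢2n : ∀ m n → + 1 + + 2 * m ≢ + 2 * n
  1+2m≢2n m n eq = even≢odd ∣ n - m ∣ 0 (sym (begin
    1                      ≡⟨⟩
    ∣ + 1 ∣                ≡⟨ cong ∣_∣ (1≡1+2m-2m m) ⟩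
    ∣ + 1 + + 2 * m - + 2 * m ∣  ≡⟨ cong (λ w → ∣ w - + 2 * m ∣) eq ⟩
    ∣ + 2 * n - + 2 * m ∣  ≡⟨ cong ∣_∣ (2n-2m≡2[n-m] n m) ⟩
    ∣ + 2 * (n - m) ∣      ≡⟨ ℤ.abs-* (+ 2) (n - m) ⟩
    2 ℕ.* ∣ n - m ∣        ∎))
    where 1≡1+2m-2m : ∀ m → + 1 ≡ + 1 + + 2 * m - + 2 * m
          1≡1+2m-2m = solve-∀
          2n-2m≡2[n-m] : ∀ n m → + 2 * n - + 2 * m ≡ + 2 * (n - m)
          2n-2m≡2[n-m] = solve-∀

  -- Primary (a + b i) says a − 1 + b i = (2 + 2i)(x + y i), i.e. b = 2(x + y) and a + b = 1 + 4x.
  primary⇒ : ∀ z → Primary z → (∃ λ t → im z ≡ + 2 * t) × (∃ λ u → re z + im z ≡ + 1 + + 4 * u)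
  primary⇒ (a + b i) (x + y i , eq) =
    (x + y , trans (trans (b≡b-0 b) (cong im eq)) (2y+2x≡2[x+y] x y)) ,
    (x , (begin
      a + b                       ≡⟨ a+b≡1+[a-1]+[b-0] a b ⟩
      + 1 + (a - + 1) + (b - + 0)  ≡⟨ cong₂ (λ r s → + 1 + r + s) (cong re eq) (cong im eq) ⟩
      + 1 + (+ 2 * x - + 2 * y) + (+ 2 * y + + 2 * x) ≡⟨ 1+[2x-2y]+[2y+2x]≡1+4x x y ⟩
      + 1 + + 4 * x               ∎))
    where b≡b-0 : ∀ b → b ≡ b - + 0
          b≡b-0 = solve-∀
          2y+2x≡2[x+y] : ∀ x y → + 2 * y + + 2 * x ≡ + 2 * (x + y)
          2y+2x≡2[x+y] = solve-∀
          a+b≡1+[a-1]+[b-0] : ∀ a b → a + b ≡ + 1 + (a - + 1) + (b - + 0)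
          a+b≡1+[a-1]+[b-0] = solve-∀
          1+[2x-2y]+[2y+2x]≡1+4x : ∀ x y → + 1 + (+ 2 * x - + 2 * y) + (+ 2 * y + + 2 * x) ≡ + 1 + + 4 * x
          1+[2x-2y]+[2y+2x]≡1+4x = solve-∀

  primary⁺ : ∀ a b → (∃ λ t → b ≡ + 2 * t) → (∃ λ u → a + b ≡ + 1 + + 4 * u) → Primary (a + b i)
  primary⁺ a b (t , b≡2t) (u , a+b≡1+4u) = u + (t - u) i , cong₂ _+_i
    (begin
      a - + 1                       ≡⟨ a-1≡[a+b]-1-b a b ⟩
      (a + b) - + 1 - b             ≡⟨ cong₂ (λ r s → r - + 1 - s) a+b≡1+4u b≡2t ⟩
      (+ 1 + + 4 * u) - + 1 - + 2 * t ≡⟨ 4u-2t≡2u-2[t-u] u t ⟩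
      + 2 * u - + 2 * (t - u)       ∎)
    (begin
      b - + 0                       ≡⟨ cong (_- + 0) b≡2t ⟩
      + 2 * t - + 0                 ≡⟨ 2t≡2[t-u]+2u t u ⟩
      + 2 * (t - u) + + 2 * u       ∎)
    where a-1≡[a+b]-1-b : ∀ a b → a - + 1 ≡ (a + b) - + 1 - b
          a-1≡[a+b]-1-b = solve-∀
          4u-2t≡2u-2[t-u] : ∀ u t → (+ 1 + + 4 * u) - + 1 - + 2 * t ≡ + 2 * u - + 2 * (t - u)
          4u-2t≡2u-2[t-u] = solve-∀
          2t≡2[t-u]+2u : ∀ t u → + 2 * t - + 0 ≡ + 2 * (t - u) + + 2 * u
          2t≡2[t-u]+2u = solve-∀

  primary⇒re-odd : ∀ z → Primary z → ∃ λ s → re z ≡ + 1 + + 2 * s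
  primary⇒re-odd (a + b i) P with primary⇒ (a + b i) P
  ... | (t , b≡2t) , (u , a+b≡1+4u) = + 2 * u - t , (begin
    a                        ≡⟨ a≡[a+b]-b a b ⟩
    (a + b) - b              ≡⟨ cong₂ _-_ a+b≡1+4u b≡2t ⟩
    (+ 1 + + 4 * u) - + 2 * t ≡⟨ 1+4u-2t≡1+2[2u-t] u t ⟩
    + 1 + + 2 * (+ 2 * u - t) ∎)
    where a≡[a+b]-b : ∀ a b → a ≡ (a + b) - b
          a≡[a+b]-b = solve-∀
          1+4u-2t≡1+2[2u-t] : ∀ u t → (+ 1 + + 4 * u) - + 2 * t ≡ + 1 + + 2 * (+ 2 * u - t)
          1+4u-2t≡1+2[2u-t] = solve-∀

  primary⇒re≢0 : ∀ z → Primary z → re z ≢ + 0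
  primary⇒re≢0 z P a≡0 with primary⇒re-odd z P
  ... | s , a≡1+2s = 1+2m≢2n s (+ 0) (trans (sym a≡1+2s) a≡0)

  primary-conj : ∀ z → Primary z → Primary (conj z)
  primary-conj (a + b i) P with primary⇒ (a + b i) P
  ... | (t , b≡2t) , (u , a+b≡1+4u) = primary⁺ a (- b) (- t , trans (cong -_ b≡2t) (-[2t]≡2[-t] t))
    (u - t , (begin
      a - b                      ≡⟨ a-b≡[a+b]-2b a b ⟩
      (a + b) - + 2 * b          ≡⟨ cong₂ (λ r s → r - + 2 * s) a+b≡1+4u b≡2t ⟩
      + 1 + + 4 * u - + 2 * (+ 2 * t) ≡⟨ 1+4u-4t≡1+4[u-t] u t ⟩
      + 1 + + 4 * (u - t)        ∎))
    where -[2t]≡2[-t] : ∀ t → - (+ 2 * t) ≡ + 2 * (- t)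
          -[2t]≡2[-t] = solve-∀
          a-b≡[a+b]-2b : ∀ a b → a + - b ≡ (a + b) - + 2 * b
          a-b≡[a+b]-2b = solve-∀
          1+4u-4t≡1+4[u-t] : ∀ u t → + 1 + + 4 * u - + 2 * (+ 2 * t) ≡ + 1 + + 4 * (u - t)
          1+4u-4t≡1+4[u-t] = solve-∀

  primary-*Unit : ∀ z u → Primary z → Primary (z *𝔾 u) → Unit u → u ≡ 1𝔾
  primary-*Unit _ _ _ _ u₁ = refl
  primary-*Unit (a + b i) _ P Pz-1 u₋₁ with primary⇒ (a + b i) P | primary⇒ ((a + b i) *𝔾 -1𝔾) Pz-1
  ... | _ , (u , a+b≡1+4u) | _ , (u′ , -a-b≡1+4u′) =
    ⊥-elim (1+2m≢2n (u + u′) (+ 0) (ℤ.*-cancelˡ-≡ (+ 2) _ _ (begin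
      + 2 * (+ 1 + + 2 * (u + u′))               ≡⟨ 2[1+2[u+u′]]≡[1+4u]+[1+4u′] u u′ ⟩
      (+ 1 + + 4 * u) + (+ 1 + + 4 * u′)         ≡⟨ cong₂ _+_ a+b≡1+4u -a-b≡1+4u′ ⟨
      (a + b) + ((a * -[1+ 0 ] - b * + 0) + (a * + 0 + b * -[1+ 0 ])) ≡⟨ z+[-z]≡0 a b ⟩
      + 2 * (+ 2 * + 0)                          ∎)))
    where 2[1+2[u+u′]]≡[1+4u]+[1+4u′] : ∀ u u′ → + 2 * (+ 1 + + 2 * (u + u′)) ≡ (+ 1 + + 4 * u) + (+ 1 + + 4 * u′)
          2[1+2[u+u′]]≡[1+4u]+[1+4u′] = solve-∀
          z+[-z]≡0 : ∀ a b → (a + b) + ((a * -[1+ 0 ] - b * + 0) + (a * + 0 + b * -[1+ 0 ])) ≡ + 2 * (+ 2 * + 0)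
          z+[-z]≡0 = solve-∀
  primary-*Unit (a + b i) _ P Pzi uᵢ with primary⇒ (a + b i) P | primary⇒ ((a + b i) *𝔾 i𝔾) Pzi
  ... | (t , b≡2t) , (u , a+b≡1+4u) | (t′ , a≡2t′) , _ =
    ⊥-elim (1+2m≢2n (+ 2 * u) (t′ + t) (begin
      + 1 + + 2 * (+ 2 * u)         ≡⟨ 1+2[2u]≡1+4u u ⟩
      + 1 + + 4 * u                 ≡⟨ a+b≡1+4u ⟨
      a + b                         ≡⟨ cong₂ _+_ (trans (a≡a*1+b*0 a b) a≡2t′) b≡2t ⟩
      + 2 * t′ + + 2 * t            ≡⟨ 2t′+2t≡2[t′+t] t′ t ⟩
      + 2 * (t′ + t)                ∎))
    where 1+2[2u]≡1+4u : ∀ u → + 1 + + 2 * (+ 2 * u) ≡ + 1 + + 4 * u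
          1+2[2u]≡1+4u = solve-∀
          a≡a*1+b*0 : ∀ a b → a ≡ a * + 1 + b * + 0
          a≡a*1+b*0 = solve-∀
          2t′+2t≡2[t′+t] : ∀ t′ t → + 2 * t′ + + 2 * t ≡ + 2 * (t′ + t)
          2t′+2t≡2[t′+t] = solve-∀
  primary-*Unit (a + b i) _ P Pz-i u₋ᵢ with primary⇒ (a + b i) P | primary⇒ ((a + b i) *𝔾 -i𝔾) Pz-i
  ... | (t , b≡2t) , (u , a+b≡1+4u) | (t′ , -a≡2t′) , _ =
    ⊥-elim (1+2m≢2n (+ 2 * u) (t - t′) (begin
      + 1 + + 2 * (+ 2 * u)         ≡⟨ 1+2[2u]≡1+4u u ⟩
      + 1 + + 4 * u                 ≡⟨ a+b≡1+4u ⟨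
      a + b                         ≡⟨ cong (_+ b) (a≡-[a*-1+b*0] a b) ⟩
      - (a * -[1+ 0 ] + b * + 0) + b ≡⟨ cong₂ (λ r s → - r + s) -a≡2t′ b≡2t ⟩
      - (+ 2 * t′) + + 2 * t        ≡⟨ -2t′+2t≡2[t-t′] t′ t ⟩
      + 2 * (t - t′)                ∎))
    where 1+2[2u]≡1+4u : ∀ u → + 1 + + 2 * (+ 2 * u) ≡ + 1 + + 4 * u
          1+2[2u]≡1+4u = solve-∀
          a≡-[a*-1+b*0] : ∀ a b → a ≡ - (a * -[1+ 0 ] + b * + 0)
          a≡-[a*-1+b*0] = solve-∀
          -2t′+2t≡2[t-t′] : ∀ t′ t → - (+ 2 * t′) + + 2 * t ≡ + 2 * (t - t′)
          -2t′+2t≡2[t-t′] = solve-∀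

module GaussianPrimes where
  open GaussianIntegers
  open PrimaryElements
  open FermatTwoSquares using (prime≡1+4k⇒oddSquare+4square; even⊎odd)
  open import Data.Integer using (ℤ; +_; -[1+_]; _+_; _*_; _-_; -_; ∣_∣; _<_; +<+)
  import Data.Integer.Properties as ℤ
  open import Data.Integer.Tactic.RingSolver using (solve-∀)
  import Data.Integer.Divisibility.Signed as ℤ∣
  open ℤ∣ using (divides) renaming (_∣_ to _∣ℤ_)
  import Data.Nat as ℕ
  open ℕ using (ℕ; zero; suc)
  import Data.Nat.Properties as ℕ
  import Data.Nat.Tactic.RingSolver as ℕ-Solver
  open import Data.Nat.Divisibility using (divides; ∣⇒≤) renaming (_∣_ to _∣ℕ_)
  open import Data.Nat.ListAction using (product)
  open import Data.Nat.Primality using (Prime; euclidsLemma; prime⇒irreducible; prime⇒nonTrivial; prime⇒nonZero)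
  open import Data.Nat.Primality.Factorisation using (factorise; PrimeFactorisation)
  open import Data.List using ([]; _∷_)
  open import Data.List.Membership.Propositional using (_∈_)
  open import Data.List.Relation.Unary.Any using (here; there)
  import Data.List.Relation.Unary.All as All
  open import Data.Product using (∃; _×_; _,_)
  open import Data.Sum using (_⊎_; inj₁; inj₂; [_,_]′)
  open import Data.Empty using (⊥; ⊥-elim)
  open import Function using (_∘_)
  open import Relation.Binary.PropositionalEquality
  open ≡-Reasoning

  private
    euclidsLemmaℤ : ∀ {p} → Prime p → ∀ X Y → + p ∣ℤ X * Y → + p ∣ℤ X ⊎ + p ∣ℤ Y
    euclidsLemmaℤ p-prime X Y p∣XY = Data.Sum.map ℤ∣.∣ᵤ⇒∣ ℤ∣.∣ᵤ⇒∣
      (euclidsLemma ∣ X ∣ ∣ Y ∣ p-prime (subst (_ ∣ℕ_) (ℤ.abs-* X Y) (ℤ∣.∣⇒∣ᵤ p∣XY)))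

  -- Write z π̄ = R z + (I z) i. Then π ∣ z iff p ∣ R z, and R is multiplicative modulo p up to the factor A.
  module _ (π : 𝔾) (p-prime : Prime (𝐍 π)) (A≢0 : re π ≢ + 0) (B≢0 : im π ≢ + 0) where
    private
      A = re π
      B = im π
      p = 𝐍 π

      p≡A²+B² : + p ≡ A * A + B * B
      p≡A²+B² = +𝐍 π

      R I : 𝔾 → ℤ
      R (u + v i) = u * A + v * B
      I (u + v i) = v * A - u * B

      *conj≡R+Ii : ∀ z → z *𝔾 conj π ≡ R z + I z i
      *conj≡R+Ii (u + v i) = cong₂ _+_i (re≡ u v A B) (im≡ u v A B)
        where re≡ : ∀ u v A B → u * A - v * (- B) ≡ u * A + v * B
              re≡ = solve-∀
              im≡ : ∀ u v A B → u * (- B) + v * A ≡ v * A - u * B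
              im≡ = solve-∀

      p>1 : 1 ℕ.< p
      p>1 = ℕ.nonTrivial⇒n>1 p {{prime⇒nonTrivial p-prime}}

      π*w*conj≡p*w : ∀ w → (π *𝔾 w) *𝔾 conj π ≡ (+ p * re w) + (+ p * im w) i
      π*w*conj≡p*w w = begin
        (π *𝔾 w) *𝔾 conj π   ≡⟨ *𝔾-assoc π w (conj π) ⟩
        π *𝔾 (w *𝔾 conj π)   ≡⟨ cong (π *𝔾_) (*𝔾-comm w (conj π)) ⟩
        π *𝔾 (conj π *𝔾 w)   ≡⟨ *𝔾-assoc π (conj π) w ⟨
        (π *𝔾 conj π) *𝔾 w   ≡⟨ cong (_*𝔾 w) (*-conj≡ι𝐍 π) ⟩
        ι p *𝔾 w             ≡⟨ cong₂ _+_i (re≡ (+ p) (re w) (im w)) (im≡ (+ p) (re w) (im w)) ⟩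
        (+ p * re w) + (+ p * im w) i ∎
        where re≡ : ∀ P r s → P * r - + 0 * s ≡ P * r
              re≡ = solve-∀
              im≡ : ∀ P r s → P * s + + 0 * r ≡ P * s
              im≡ = solve-∀

      π∣⇒p∣R : ∀ z → π ∣𝔾 z → + p ∣ℤ R z
      π∣⇒p∣R z (w , z≡πw) = divides (re w) (begin
        R z                          ≡⟨ cong re (*conj≡R+Ii z) ⟨
        re (z *𝔾 conj π)             ≡⟨ cong (λ t → re (t *𝔾 conj π)) z≡πw ⟩
        re ((π *𝔾 w) *𝔾 conj π)      ≡⟨ cong re (π*w*conj≡p*w w) ⟩
        + p * re w                   ≡⟨ ℤ.*-comm (+ p) (re w) ⟩
        re w * + p                   ∎)

      p∤A : + p ∣ℤ A → ⊥
      p∤A p∣A = ℕ.<⇒≱ ∣A∣<p (∣⇒≤ {{ℕ.≢-nonZero ∣A∣≢0}} (ℤ∣.∣⇒∣ᵤ p∣A))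
        where
        ∣A∣≢0 : ∣ A ∣ ≢ 0
        ∣A∣≢0 = A≢0 ∘ ℤ.∣i∣≡0⇒i≡0
        ∣A∣<p : ∣ A ∣ ℕ.< p
        ∣A∣<p = subst (∣ A ∣ ℕ.<_) (sym (𝐍≡∣re∣²+∣im∣² π))
                  (m<m²+n² ∣ A ∣ ∣ B ∣ ∣A∣≢0 (B≢0 ∘ ℤ.∣i∣≡0⇒i≡0))
          where m<m²+n² : ∀ m n → m ≢ 0 → n ≢ 0 → m ℕ.< m ℕ.* m ℕ.+ n ℕ.* n
                m<m²+n² zero    _       m≢0 _   = ⊥-elim (m≢0 refl)
                m<m²+n² (suc _) zero    _   n≢0 = ⊥-elim (n≢0 refl)
                m<m²+n² (suc m) (suc n) _   _   =
                  ℕ.≤-<-trans (ℕ.m≤m*n (suc m) (suc m)) (ℕ.m<m+n _ (ℕ.s≤s ℕ.z≤n))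

      p∣R⇒p∣I : ∀ z → + p ∣ℤ R z → + p ∣ℤ I z
      p∣R⇒p∣I (u + v i) p∣R = [ ⊥-elim ∘ p∤A , (λ p∣I → p∣I) ]′ (euclidsLemmaℤ p-prime A (v * A - u * B) p∣A*I)
        where
        A*I≡ : A * (v * A - u * B) ≡ v * + p - B * (u * A + v * B)
        A*I≡ = trans (expand u v A B) (cong (λ P → v * P - B * (u * A + v * B)) (sym p≡A²+B²))
          where expand : ∀ u v A B → A * (v * A - u * B) ≡ v * (A * A + B * B) - B * (u * A + v * B)
                expand = solve-∀
        p∣A*I : + p ∣ℤ A * (v * A - u * B)
        p∣A*I = subst (+ p ∣ℤ_) (sym A*I≡) (ℤ∣.∣m∣n⇒∣m-n (ℤ∣.∣n⇒∣m*n v ℤ∣.∣-refl) (ℤ∣.∣n⇒∣m*n B p∣R))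

      p∣R∧p∣I⇒π∣ : ∀ z → + p ∣ℤ R z → + p ∣ℤ I z → π ∣𝔾 z
      p∣R∧p∣I⇒π∣ z (divides r R≡rp) (divides s I≡sp) = w , *𝔾-cancelˡ (conj π) z (π *𝔾 w) conjπ≢0 (begin
        conj π *𝔾 z          ≡⟨ *𝔾-comm (conj π) z ⟩
        z *𝔾 conj π          ≡⟨ *conj≡R+Ii z ⟩
        R z + I z i          ≡⟨ cong₂ _+_i (trans R≡rp (ℤ.*-comm r (+ p))) (trans I≡sp (ℤ.*-comm s (+ p))) ⟩
        (+ p * r) + (+ p * s) i ≡⟨ π*w*conj≡p*w w ⟨
        (π *𝔾 w) *𝔾 conj π   ≡⟨ *𝔾-comm (π *𝔾 w) (conj π) ⟩
        conj π *𝔾 (π *𝔾 w)   ∎)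
        where
        w = r + s i
        conjπ≢0 : conj π ≢ 0𝔾
        conjπ≢0 conjπ≡0 = ℕ.<-irrefl (sym (trans (sym (𝐍-conj π)) (cong 𝐍 conjπ≡0)))
                            (ℕ.<-trans (ℕ.s≤s ℕ.z≤n) p>1)

      R-* : ∀ x y → R x * R y ≡ A * R (x *𝔾 y) + + p * (im x * im y)
      R-* (u + v i) (s + t i) = trans (expand u v s t A B)
        (cong (λ P → A * ((u * s - v * t) * A + (u * t + v * s) * B) + P * (v * t)) (sym p≡A²+B²))
        where expand : ∀ u v s t A B → (u * A + v * B) * (s * A + t * B)
                         ≡ A * ((u * s - v * t) * A + (u * t + v * s) * B) + (A * A + B * B) * (v * t)
              expand = solve-∀

    𝐍-prime⇒Prime𝔾 : Prime𝔾 π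
    𝐍-prime⇒Prime𝔾 = record
      { nonzero = λ π≡0 → ℕ.<-irrefl (sym (cong 𝐍 π≡0)) (ℕ.<-trans (ℕ.s≤s ℕ.z≤n) p>1)
      ; nonunit = λ π-unit → ℕ.<-irrefl (sym (IsUnit𝔾⇒𝐍≡1 π π-unit)) p>1
      ; prime   = λ x y π∣xy → Data.Sum.map (divides-via x) (divides-via y)
                    (euclidsLemmaℤ p-prime (R x) (R y) (p∣R*R x y π∣xy))
      }
      where
      divides-via : ∀ z → + p ∣ℤ R z → π ∣𝔾 z
      divides-via z p∣R = p∣R∧p∣I⇒π∣ z p∣R (p∣R⇒p∣I z p∣R)
      p∣R*R : ∀ x y → π ∣𝔾 (x *𝔾 y) → + p ∣ℤ R x * R y
      p∣R*R x y π∣xy = subst (+ p ∣ℤ_) (sym (R-* x y))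
        (ℤ∣.∣m∣n⇒∣m+n (ℤ∣.∣n⇒∣m*n A (π∣⇒p∣R (x *𝔾 y) π∣xy)) (ℤ∣.∣m⇒∣m*n (im x * im y) ℤ∣.∣-refl))

  Prime𝔾-∣ι-product : ∀ {π} → Prime𝔾 π → ∀ qs → π ∣𝔾 ι (product qs) → ∃ λ q → q ∈ qs × π ∣𝔾 ι q
  Prime𝔾-∣ι-product π-prime [] (w , 1≡πw) = ⊥-elim (Prime𝔾.nonunit π-prime (w , sym 1≡πw))
  Prime𝔾-∣ι-product {π} π-prime (q ∷ qs) π∣
    with Prime𝔾.prime π-prime (ι q) (ι (product qs)) (subst (π ∣𝔾_) (ι-* q (product qs)) π∣)
  ... | inj₁ π∣q = q , here refl , π∣q
  ... | inj₂ π∣rest = let q′ , q′∈ , π∣q′ = Prime𝔾-∣ι-product π-prime qs π∣rest in q′ , there q′∈ , π∣q′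

  Prime𝔾-∣ι⇒∣ι-prime : ∀ {π} n → .{{ℕ.NonZero n}} → Prime𝔾 π → π ∣𝔾 ι n → ∃ λ q → Prime q × π ∣𝔾 ι q
  Prime𝔾-∣ι⇒∣ι-prime {π} n π-prime π∣n =
    let q , q∈ , π∣q = Prime𝔾-∣ι-product π-prime factors (subst (λ m → π ∣𝔾 ι m) isFactorisation π∣n)
    in q , All.lookup factorsPrime q∈ , π∣q
    where open PrimeFactorisation (factorise n)

  m*n≡p²⇒ : ∀ {p} m n → Prime p → m ℕ.* n ≡ p ℕ.* p → m ≡ 1 ⊎ m ≡ p ⊎ n ≡ 1
  m*n≡p²⇒ {p} m n p-prime mn≡pp with euclidsLemma m n p-prime (divides p mn≡pp)
  ... | inj₁ (divides s m≡sp) with prime⇒irreducible p-prime (divides s (ℕ.*-cancelʳ-≡ p (s ℕ.* n) p (begin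
        p ℕ.* p         ≡⟨ mn≡pp ⟨
        m ℕ.* n         ≡⟨ cong (ℕ._* n) m≡sp ⟩
        s ℕ.* p ℕ.* n   ≡⟨ swap s p n ⟩
        s ℕ.* n ℕ.* p   ∎)))
    where instance _ = prime⇒nonZero p-prime
          swap : ∀ a b c → a ℕ.* b ℕ.* c ≡ a ℕ.* c ℕ.* b
          swap a b c = trans (ℕ.*-assoc a b c) (trans (cong (a ℕ.*_) (ℕ.*-comm b c)) (sym (ℕ.*-assoc a c b)))
  ...   | inj₁ n≡1 = inj₂ (inj₂ n≡1)
  ...   | inj₂ refl = inj₂ (inj₁ (trans m≡sp (trans (cong (ℕ._* p) s≡1) (ℕ.*-identityˡ p))))
    where instance _ = prime⇒nonZero p-prime
          s≡1 : s ≡ 1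
          s≡1 = ℕ.*-cancelʳ-≡ s 1 n (trans (ℕ.*-cancelʳ-≡ (s ℕ.* n) n n (trans (cong (ℕ._* n) (sym m≡sp)) mn≡pp))
                                           (sym (ℕ.*-identityˡ n)))
  m*n≡p²⇒ {p} m n p-prime mn≡pp | inj₂ (divides t n≡tp)
    with prime⇒irreducible p-prime (divides t (ℕ.*-cancelʳ-≡ p (t ℕ.* m) p (begin
        p ℕ.* p         ≡⟨ mn≡pp ⟨
        m ℕ.* n         ≡⟨ cong (m ℕ.*_) n≡tp ⟩
        m ℕ.* (t ℕ.* p) ≡⟨ ℕ.*-assoc m t p ⟨
        m ℕ.* t ℕ.* p   ≡⟨ cong (ℕ._* p) (ℕ.*-comm m t) ⟩
        t ℕ.* m ℕ.* p   ∎)))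
    where instance _ = prime⇒nonZero p-prime
  ... | inj₁ m≡1 = inj₁ m≡1
  ... | inj₂ m≡p = inj₂ (inj₁ m≡p)

  im-*Unit≢0 : ∀ z u → re z ≢ + 0 → im z ≢ + 0 → Unit u → im (z *𝔾 u) ≢ + 0
  im-*Unit≢0 (a + b i) _ _   b≢0 u₁  eq = b≢0 (trans (im≡ a b) eq)
    where im≡ : ∀ a b → b ≡ a * + 0 + b * + 1
          im≡ = solve-∀
  im-*Unit≢0 (a + b i) _ _   b≢0 u₋₁ eq = b≢0 (ℤ.neg-injective (trans (im≡ a b) eq))
    where im≡ : ∀ a b → - b ≡ a * + 0 + b * -[1+ 0 ]
          im≡ = solve-∀
  im-*Unit≢0 (a + b i) _ a≢0 _   uᵢ  eq = a≢0 (trans (im≡ a b) eq)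
    where im≡ : ∀ a b → a ≡ a * + 1 + b * + 0
          im≡ = solve-∀
  im-*Unit≢0 (a + b i) _ a≢0 _   u₋ᵢ eq = a≢0 (ℤ.neg-injective (trans (im≡ a b) eq))
    where im≡ : ∀ a b → - a ≡ a * -[1+ 0 ] + b * + 0
          im≡ = solve-∀

  private
    0<⇒≢0 : ∀ {b} → + 0 < b → b ≢ + 0
    0<⇒≢0 0<b b≡0 = ℤ.<-irrefl (sym b≡0) 0<b

  -- π divides π π̄ = 𝐍 π, hence some rational prime q = π μ; comparing norms, 𝐍 π = q unless
  -- μ is a unit, which is impossible as π is not associate to a real number.
  𝒫⇒Prime-𝐍 : ∀ π → In𝒫 π → Prime (𝐍 π)
  𝒫⇒Prime-𝐍 π (π-prime , π-primary , 0<im) with Prime𝔾-∣ι⇒∣ι-prime (𝐍 π) {{≢0⇒𝐍≢0 (Prime𝔾.nonzero π-prime)}}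
                                                   π-prime (conj π , sym (*-conj≡ι𝐍 π))
  ... | q , q-prime , μ , ιq≡πμ with m*n≡p²⇒ (𝐍 π) (𝐍 μ) q-prime (trans (sym (𝐍-* π μ)) (trans (cong 𝐍 (sym ιq≡πμ)) (𝐍-ι q)))
  ...   | inj₁ 𝐍π≡1         = ⊥-elim (Prime𝔾.nonunit π-prime (𝐍≡1⇒IsUnit𝔾 π 𝐍π≡1))
  ...   | inj₂ (inj₁ 𝐍π≡q)  = subst Prime (sym 𝐍π≡q) q-prime
  ...   | inj₂ (inj₂ 𝐍μ≡1)  = ⊥-elim (im-*Unit≢0 π μ (primary⇒re≢0 π π-primary) (0<⇒≢0 0<im)
                                        (𝐍≡1⇒Unit μ 𝐍μ≡1) (sym (cong im ιq≡πμ)))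

  primary-associate-same-𝐍 : ∀ π ρ μ → π ≢ 0𝔾 → Primary π → Primary ρ → ρ ≡ π *𝔾 μ → 𝐍 ρ ≡ 𝐍 π → ρ ≡ π
  primary-associate-same-𝐍 π ρ μ π≢0 π-primary ρ-primary ρ≡πμ 𝐍ρ≡𝐍π = begin
    ρ          ≡⟨ ρ≡πμ ⟩
    π *𝔾 μ     ≡⟨ cong (π *𝔾_) μ≡1 ⟩
    π *𝔾 1𝔾    ≡⟨ *𝔾-identityʳ π ⟩
    π          ∎
    where
    instance _ = ≢0⇒𝐍≢0 π≢0
    𝐍μ≡1 : 𝐍 μ ≡ 1
    𝐍μ≡1 = ℕ.*-cancelˡ-≡ (𝐍 μ) 1 (𝐍 π)
             (trans (sym (𝐍-* π μ)) (trans (cong 𝐍 (sym ρ≡πμ)) (trans 𝐍ρ≡𝐍π (sym (ℕ.*-identityʳ (𝐍 π))))))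
    μ≡1 : μ ≡ 1𝔾
    μ≡1 = primary-*Unit π μ π-primary (subst Primary ρ≡πμ ρ-primary) (𝐍≡1⇒Unit μ 𝐍μ≡1)

  -- π divides π′ π̄′ = π π̄, so it divides π′ or π̄′; the latter has negative imaginary part.
  𝒫-𝐍-injective : ∀ π π′ → In𝒫 π → In𝒫 π′ → 𝐍 π ≡ 𝐍 π′ → π ≡ π′
  𝒫-𝐍-injective π π′ (π-prime , π-primary , 0<im) (_ , π′-primary , 0<im′) 𝐍π≡𝐍π′
    with Prime𝔾.prime π-prime π′ (conj π′) (conj π , (begin
      π′ *𝔾 conj π′  ≡⟨ *-conj≡ι𝐍 π′ ⟩
      ι (𝐍 π′)       ≡⟨ cong ι 𝐍π≡𝐍π′ ⟨
      ι (𝐍 π)        ≡⟨ *-conj≡ι𝐍 π ⟨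
      π *𝔾 conj π    ∎))
  ... | inj₁ (μ , π′≡πμ) = sym (primary-associate-same-𝐍 π π′ μ (Prime𝔾.nonzero π-prime) π-primary π′-primary
                                  π′≡πμ (sym 𝐍π≡𝐍π′))
  ... | inj₂ (μ , π̄′≡πμ) = ⊥-elim (ℤ.<-asym 0<im (subst (_< + 0) (cong im π̄′≡π) (ℤ.neg-mono-< 0<im′)))
    where π̄′≡π = primary-associate-same-𝐍 π (conj π′) μ (Prime𝔾.nonzero π-prime) π-primary
                   (primary-conj π′ π′-primary) π̄′≡πμ (trans (𝐍-conj π′) (sym 𝐍π≡𝐍π′))

  private
    +[2n] : ∀ n → + (2 ℕ.* n) ≡ + 2 * + n
    +[2n] n = ℤ.pos-* 2 n

    +[1+2n] : ∀ n → + suc (2 ℕ.* n) ≡ + 1 + + 2 * + n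
    +[1+2n] n = trans (ℤ.pos-+ 1 (2 ℕ.* n)) (cong (λ t → + 1 + t) (+[2n] n))

    module _ {p s y : ℕ} (p-prime : Prime p) (p≡ : suc (2 ℕ.* s) ℕ.* suc (2 ℕ.* s) ℕ.+ 4 ℕ.* (y ℕ.* y) ≡ p)
             (1≤y : 1 ℕ.≤ y) where

      𝒫-of-norm-p : ∀ a → ∣ a ∣ ≡ suc (2 ℕ.* s) → Primary (a + (+ (2 ℕ.* y)) i) → ∃ λ π → In𝒫 π × 𝐍 π ≡ p
      𝒫-of-norm-p a ∣a∣≡ π-primary = π , (π-prime , π-primary , 0<2y) , 𝐍π≡p
        where
        π = a + (+ (2 ℕ.* y)) i
        𝐍π≡p : 𝐍 π ≡ p
        𝐍π≡p = begin
          𝐍 π                                             ≡⟨ 𝐍≡∣re∣²+∣im∣² π ⟩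
          ∣ a ∣ ℕ.* ∣ a ∣ ℕ.+ 2 ℕ.* y ℕ.* (2 ℕ.* y)      ≡⟨ cong₂ (λ m n → m ℕ.* m ℕ.+ n) ∣a∣≡ (2y*2y≡4y² y) ⟩
          suc (2 ℕ.* s) ℕ.* suc (2 ℕ.* s) ℕ.+ 4 ℕ.* (y ℕ.* y) ≡⟨ p≡ ⟩
          p                                               ∎
          where open ≡-Reasoning
                2y*2y≡4y² : ∀ y → 2 ℕ.* y ℕ.* (2 ℕ.* y) ≡ 4 ℕ.* (y ℕ.* y)
                2y*2y≡4y² = ℕ-Solver.solve-∀
        0<2y : + 0 < + (2 ℕ.* y)
        0<2y = +<+ (ℕ.≤-trans 1≤y (ℕ.m≤m+n y (y ℕ.+ 0)))
        π-prime : Prime𝔾 π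
        π-prime = 𝐍-prime⇒Prime𝔾 π (subst Prime (sym 𝐍π≡p) p-prime)
                    (λ a≡0 → ℕ.0≢1+n (trans (sym (cong ∣_∣ a≡0)) ∣a∣≡))
                    (λ 2y≡0 → ℤ.<-irrefl (sym 2y≡0) 0<2y)

  -- Of ±(2s + 1) + 2y i, the primary one is determined by the parity of s + y.
  prime≡1+4k⇒∃𝒫 : ∀ p k → Prime p → p ≡ 1 ℕ.+ 4 ℕ.* k → ∃ λ π → In𝒫 π × 𝐍 π ≡ p
  prime≡1+4k⇒∃𝒫 p k p-prime p≡1+4k with prime≡1+4k⇒oddSquare+4square p k p-prime p≡1+4k
  ... | s , y , p≡ , 1≤y with even⊎odd (s ℕ.+ y)
  ...   | w , inj₁ s+y≡2w = 𝒫-of-norm-p {p} {s} {y} p-prime p≡ 1≤y (+ suc (2 ℕ.* s)) refl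
            (primary⁺ (+ suc (2 ℕ.* s)) (+ (2 ℕ.* y)) (+ y , +[2n] y) (+ w , (begin
              + suc (2 ℕ.* s) + + (2 ℕ.* y)  ≡⟨ cong₂ _+_ (+[1+2n] s) (+[2n] y) ⟩
              + 1 + + 2 * S + + 2 * Y        ≡⟨ 1+2S+2Y≡1+2[S+Y] S Y ⟩
              + 1 + + 2 * (S + Y)            ≡⟨ cong (λ t → + 1 + + 2 * t) S+Y≡2W ⟩
              + 1 + + 2 * (+ 2 * W)          ≡⟨ 1+2[2W]≡1+4W W ⟩
              + 1 + + 4 * W                  ∎)))
    where
    open ≡-Reasoning
    S = + s
    Y = + y
    W = + w
    S+Y≡2W : S + Y ≡ + 2 * W
    S+Y≡2W = trans (sym (ℤ.pos-+ s y)) (trans (cong +_ s+y≡2w) (+[2n] w))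
    1+2S+2Y≡1+2[S+Y] : ∀ S Y → + 1 + + 2 * S + + 2 * Y ≡ + 1 + + 2 * (S + Y)
    1+2S+2Y≡1+2[S+Y] = solve-∀
    1+2[2W]≡1+4W : ∀ W → + 1 + + 2 * (+ 2 * W) ≡ + 1 + + 4 * W
    1+2[2W]≡1+4W = solve-∀
  ...   | w , inj₂ s+y≡1+2w = 𝒫-of-norm-p {p} {s} {y} p-prime p≡ 1≤y -[1+ 2 ℕ.* s ] refl
            (primary⁺ -[1+ 2 ℕ.* s ] (+ (2 ℕ.* y)) (+ y , +[2n] y) (W - S , (begin
              -[1+ 2 ℕ.* s ] + + (2 ℕ.* y)    ≡⟨ cong₂ _+_ (cong -_ (+[1+2n] s)) (+[2n] y) ⟩
              - (+ 1 + + 2 * S) + + 2 * Y     ≡⟨ via-S+Y S Y ⟩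
              - (+ 1 + + 2 * S) + + 2 * (S + Y) - + 2 * S  ≡⟨ cong (λ t → - (+ 1 + + 2 * S) + + 2 * t - + 2 * S) S+Y≡1+2W ⟩
              - (+ 1 + + 2 * S) + + 2 * (+ 1 + + 2 * W) - + 2 * S ≡⟨ simplify S W ⟩
              + 1 + + 4 * (W - S)             ∎)))
    where
    open ≡-Reasoning
    S = + s
    Y = + y
    W = + w
    S+Y≡1+2W : S + Y ≡ + 1 + + 2 * W
    S+Y≡1+2W = trans (sym (ℤ.pos-+ s y)) (trans (cong +_ s+y≡1+2w) (+[1+2n] w))
    via-S+Y : ∀ S Y → - (+ 1 + + 2 * S) + + 2 * Y ≡ - (+ 1 + + 2 * S) + + 2 * (S + Y) - + 2 * S
    via-S+Y = solve-∀
    simplify : ∀ S W → - (+ 1 + + 2 * S) + + 2 * (+ 1 + + 2 * W) - + 2 * S ≡ + 1 + + 4 * (W - S)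
    simplify = solve-∀

open GaussianIntegers
open GaussianPrimes

open import Data.Nat as ℕ using (ℕ; zero; suc; _+_; _*_; _≤_; _<_; z≤n; s≤s; _%_; _/_)
import Data.Nat.Properties as ℕ
open import Data.Nat.DivMod using (m≡m%n+[m/n]*n; m∣n⇒o%n%m≡o%m)
open import Data.Nat.Divisibility using (_∣_; divides; ∣1⇒≡1)
open import Data.Nat.Primality using (Prime; euclidsLemma; prime⇒irreducible; prime⇒nonTrivial; prime⇒nonZero)
open import Data.Nat.GCD using (gcd)
open import Data.Integer using (+_)
open import Data.Fin as Fin using (Fin; zero; suc; inject₁)
open import Data.List using (_∷_; [])
open import Data.List.Membership.Propositional using (_∈_)
open import Data.List.Relation.Unary.Any using (here; there)
open import Data.Product using (∃; _×_; _,_; proj₁; proj₂)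
open import Data.Sum using (inj₁; inj₂)
open import Data.Empty using (⊥-elim)
open import Function using (_∘_)
open import Relation.Binary.PropositionalEquality

prodℕ-cong : ∀ {m} {f g : Fin m → ℕ} → (∀ i → f i ≡ g i) → prodℕ f ≡ prodℕ g
prodℕ-cong {zero}  _   = refl
prodℕ-cong {suc m} f≗g = cong₂ _*_ (f≗g zero) (prodℕ-cong (f≗g ∘ suc))

prod𝔾-cong : ∀ {m} {f g : Fin m → 𝔾} → (∀ i → f i ≡ g i) → prod𝔾 f ≡ prod𝔾 g
prod𝔾-cong {zero}  _   = refl
prod𝔾-cong {suc m} f≗g = cong₂ _*𝔾_ (f≗g zero) (prod𝔾-cong (f≗g ∘ suc))

𝐍-prod𝔾 : ∀ {m} (l : Fin m → 𝔾) → 𝐍 (prod𝔾 l) ≡ prodℕ (𝐍 ∘ l)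
𝐍-prod𝔾 {zero}  _ = refl
𝐍-prod𝔾 {suc m} l = trans (𝐍-* (l zero) (prod𝔾 (l ∘ suc))) (cong (𝐍 (l zero) *_) (𝐍-prod𝔾 (l ∘ suc)))

prime∣prodℕ⇒≡ : ∀ {m} {q} (p : Fin m → ℕ) → Prime q → (∀ i → Prime (p i)) → q ∣ prodℕ p → ∃ λ i → q ≡ p i
prime∣prodℕ⇒≡ {zero} _ q-prime _ q∣1 =
  ⊥-elim (ℕ.<-irrefl (sym (∣1⇒≡1 q∣1)) (ℕ.nonTrivial⇒n>1 _ {{prime⇒nonTrivial q-prime}}))
prime∣prodℕ⇒≡ {suc m} p q-prime p-prime q∣ with euclidsLemma (p zero) (prodℕ (p ∘ suc)) q-prime q∣
... | inj₂ q∣rest = let k , q≡ = prime∣prodℕ⇒≡ (p ∘ suc) q-prime (p-prime ∘ suc) q∣rest in suc k , q≡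
... | inj₁ q∣p₀ with prime⇒irreducible (p-prime zero) q∣p₀
...   | inj₂ q≡p₀ = zero , q≡p₀
...   | inj₁ q≡1  = ⊥-elim (ℕ.<-irrefl (sym q≡1) (ℕ.nonTrivial⇒n>1 _ {{prime⇒nonTrivial q-prime}}))

Increasing : ∀ {m} → (Fin m → ℕ) → Set
Increasing p = ∀ i j → i Fin.< j → p i < p j

private
  increasing⇒minimum : ∀ {m} (p : Fin (suc m) → ℕ) → Increasing p → ∀ k → p zero ≤ p k
  increasing⇒minimum p p↑ zero    = ℕ.≤-refl
  increasing⇒minimum p p↑ (suc k) = ℕ.<⇒≤ (p↑ zero (suc k) (s≤s z≤n))

-- The least prime factor of the product is p 0 = p′ 0; cancel it and recurse.
increasing-primes-prodℕ-injective : ∀ {m} (p p′ : Fin m → ℕ) → (∀ i → Prime (p i)) → (∀ i → Prime (p′ i)) →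
                                    Increasing p → Increasing p′ → prodℕ p ≡ prodℕ p′ → ∀ i → p i ≡ p′ i
increasing-primes-prodℕ-injective {suc m} p p′ p-prime p′-prime p↑ p′↑ Πp≡Πp′ = go
  where
  p₀≡p′₀ : p zero ≡ p′ zero
  p₀≡p′₀ with prime∣prodℕ⇒≡ p′ (p-prime zero) p′-prime (divides (prodℕ (p ∘ suc)) (trans (sym Πp≡Πp′) (ℕ.*-comm (p zero) _)))
            | prime∣prodℕ⇒≡ p (p′-prime zero) p-prime (divides (prodℕ (p′ ∘ suc)) (trans Πp≡Πp′ (ℕ.*-comm (p′ zero) _)))
  ... | j , p₀≡p′ⱼ | j′ , p′₀≡pⱼ′ =
    ℕ.≤-antisym (ℕ.≤-trans (increasing⇒minimum p p↑ j′) (ℕ.≤-reflexive (sym p′₀≡pⱼ′)))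
                (ℕ.≤-trans (increasing⇒minimum p′ p′↑ j) (ℕ.≤-reflexive (sym p₀≡p′ⱼ)))
  Πrest≡Πrest′ : prodℕ (p ∘ suc) ≡ prodℕ (p′ ∘ suc)
  Πrest≡Πrest′ = ℕ.*-cancelˡ-≡ _ _ (p zero) {{prime⇒nonZero (p-prime zero)}}
                   (trans Πp≡Πp′ (cong (_* prodℕ (p′ ∘ suc)) (sym p₀≡p′₀)))
  go : ∀ k → p k ≡ p′ k
  go zero    = p₀≡p′₀
  go (suc k) = increasing-primes-prodℕ-injective (p ∘ suc) (p′ ∘ suc) (p-prime ∘ suc) (p′-prime ∘ suc)
                 (λ j k → p↑ (suc j) (suc k) ∘ s≤s) (λ j k → p′↑ (suc j) (suc k) ∘ s≤s) Πrest≡Πrest′ k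

≡1,5,9,13[mod16]⇒≡1[mod4] : ∀ n → n % 16 ∈ 1 ∷ 5 ∷ 9 ∷ 13 ∷ [] → n ≡ 1 + 4 * (n / 4)
≡1,5,9,13[mod16]⇒≡1[mod4] n n%16∈ = begin
  n                    ≡⟨ m≡m%n+[m/n]*n n 4 ⟩
  n % 4 + n / 4 * 4    ≡⟨ cong₂ _+_ n%4≡1 (ℕ.*-comm (n / 4) 4) ⟩
  1 + 4 * (n / 4)      ∎
  where
  open ≡-Reasoning
  n%4≡1 : n % 4 ≡ 1
  n%4≡1 = trans (sym (m∣n⇒o%n%m≡o%m 4 16 n (divides 4 refl))) (residue n%16∈)
    where residue : ∀ {r} → r ∈ 1 ∷ 5 ∷ 9 ∷ 13 ∷ [] → r % 4 ≡ 1
          residue (here refl)                         = refl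
          residue (there (here refl))                 = refl
          residue (there (there (here refl)))         = refl
          residue (there (there (there (here refl)))) = refl

module _ (a b c m : ℕ) (α : Fin (suc m) → ℕ) (B : Fin (suc m) → Fin (suc m) → Fin 2) (x : ℕ) where

  InT′⇒InT-𝐍 : ∀ η → InT′ a b c m α B x η → InT a b c m α B x (𝐍 η)
  InT′⇒InT-𝐍 η (l , η≡Πl , 𝐍η≤x , l∈𝒫 , 𝐍l↑ , 𝐍l%16 , 𝐍l-B , 𝐍l-q) =
    𝐍 ∘ l , trans (cong 𝐍 η≡Πl) (𝐍-prod𝔾 l) , 𝐍η≤x , (λ k → 𝒫⇒Prime-𝐍 (l k) (l∈𝒫 k)) , 𝐍l↑ , 𝐍l%16 , 𝐍l-B , 𝐍l-q

  InT′-𝐍-injective : ∀ η η′ → InT′ a b c m α B x η → InT′ a b c m α B x η′ → 𝐍 η ≡ 𝐍 η′ → η ≡ η′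
  InT′-𝐍-injective η η′ (l , η≡Πl , _ , l∈𝒫 , 𝐍l↑ , _) (l′ , η′≡Πl′ , _ , l′∈𝒫 , 𝐍l′↑ , _) 𝐍η≡𝐍η′ = begin
    η          ≡⟨ η≡Πl ⟩
    prod𝔾 l    ≡⟨ prod𝔾-cong (λ k → 𝒫-𝐍-injective (l k) (l′ k) (l∈𝒫 k) (l′∈𝒫 k) (𝐍l≡𝐍l′ k)) ⟩
    prod𝔾 l′   ≡⟨ η′≡Πl′ ⟨
    η′         ∎
    where
    open ≡-Reasoning
    𝐍l≡𝐍l′ : ∀ k → 𝐍 (l k) ≡ 𝐍 (l′ k)
    𝐍l≡𝐍l′ = increasing-primes-prodℕ-injective (𝐍 ∘ l) (𝐍 ∘ l′)
      (λ k → 𝒫⇒Prime-𝐍 (l k) (l∈𝒫 k)) (λ k → 𝒫⇒Prime-𝐍 (l′ k) (l′∈𝒫 k)) 𝐍l↑ 𝐍l′↑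
      (trans (sym (𝐍-prod𝔾 l)) (trans (cong 𝐍 (sym η≡Πl)) (trans 𝐍η≡𝐍η′ (trans (cong 𝐍 η′≡Πl′) (𝐍-prod𝔾 l′)))))

  -- Each p_k ≡ 1 (mod 4) is the norm of an element of 𝒫, and the conditions defining T′ only involve the norms.
  InT⇒∃InT′ : (∀ k → α k ∈ 1 ∷ 5 ∷ 9 ∷ 13 ∷ []) →
              ∀ n → InT a b c m α B x n → ∃ λ η → InT′ a b c m α B x η × 𝐍 η ≡ n
  InT⇒∃InT′ α-residues n (p , n≡Πp , n≤x , p-prime , p↑ , p%16 , p-B , p-q) =
    prod𝔾 l , (l , refl , subst (_≤ x) (sym 𝐍Πl≡n) n≤x , l∈𝒫 , 𝐍l↑ , 𝐍l%16 , 𝐍l-B , 𝐍l-q) , 𝐍Πl≡n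
    where
    𝒫-above : ∀ k → ∃ λ π → In𝒫 π × 𝐍 π ≡ p k
    𝒫-above k = prime≡1+4k⇒∃𝒫 (p k) (p k / 4) (p-prime k)
                  (≡1,5,9,13[mod16]⇒≡1[mod4] (p k) (subst (_∈ _) (sym (p%16 k)) (α-residues (inject₁ k))))
    l : Fin m → 𝔾
    l = proj₁ ∘ 𝒫-above
    l∈𝒫 : ∀ k → In𝒫 (l k)
    l∈𝒫 = proj₁ ∘ proj₂ ∘ 𝒫-above
    𝐍l≡p : ∀ k → 𝐍 (l k) ≡ p k
    𝐍l≡p = proj₂ ∘ proj₂ ∘ 𝒫-above
    𝐍Πl≡n : 𝐍 (prod𝔾 l) ≡ n
    𝐍Πl≡n = trans (𝐍-prod𝔾 l) (trans (prodℕ-cong 𝐍l≡p) (sym n≡Πp))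
    𝐍l↑ : Increasing (𝐍 ∘ l)
    𝐍l↑ j k j<k = subst₂ _<_ (sym (𝐍l≡p j)) (sym (𝐍l≡p k)) (p↑ j k j<k)
    𝐍l%16 : ∀ k → 𝐍 (l k) % 16 ≡ α (inject₁ k)
    𝐍l%16 k = trans (cong (_% 16) (𝐍l≡p k)) (p%16 k)
    𝐍l-B : ∀ j k → j Fin.< k → addLegendre (𝐍 (l k)) (𝐍 (l j)) ≡ B (inject₁ j) (inject₁ k)
    𝐍l-B j k j<k = trans (cong₂ addLegendre (𝐍l≡p k) (𝐍l≡p j)) (p-B j k j<k)
    𝐍l-q : ∀ k q → Prime q → q ∣ a * b * c → legendre (𝐍 (l k)) q ≡ + 1
    𝐍l-q k q q-prime q∣abc = trans (cong (λ t → legendre t q) (𝐍l≡p k)) (p-q k q q-prime q∣abc)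

lemma5p6 : (a b c : ℕ) → 0 < a → 0 < b → 0 < c
  → gcd a (gcd b c) ≡ 1
  → a * a + b * b ≡ 2 * (c * c)
  → (m : ℕ) → 1 ≤ m
  → (α : Fin (suc m) → ℕ) → (∀ i → α i ∈ 1 ∷ 5 ∷ 9 ∷ 13 ∷ [])
  → (B : Fin (suc m) → Fin (suc m) → Fin 2)
  → (x : ℕ)
  → (∀ η → InT′ a b c m α B x η → InT a b c m α B x (𝐍 η))
    × (∀ η η′ → InT′ a b c m α B x η → InT′ a b c m α B x η′ → 𝐍 η ≡ 𝐍 η′ → η ≡ η′)
    × (∀ n → InT a b c m α B x n → ∃ λ η → InT′ a b c m α B x η × 𝐍 η ≡ n)
lemma5p6 a b c _ _ _ _ _ m _ α α-residues B x =
  InT′⇒InT-𝐍 a b c m α B x , InT′-𝐍-injective a b c m α B x , InT⇒∃InT′ a b c m α B x α-residues
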